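{- Let $H$ be a hypergraph with hyperedge multiset $E$, and let $\Gamma$ be a finite abelian group. Let $\mathbf{a}\in\mathbb{R}_{\ge0}^{E}$ be given by $\mathbf{a}_x=|x|-1$. Then the number of nowhere-zero $\Gamma$-flows on $H$ equals $\chi_{P(H)^{*_{\mathbf a}}}(|\Gamma|)$.
   Context: A hypergraph $H=(E,V)$ has a finite vertex set $V$ and a finite multiset $E$ of hyperedges, each a nonempty finite multiset of elements of $V$; $|x|$ denotes the cardinality of $x$ as a multiset. The graph $\mathcal{SG}(H)$ has vertex set $V$; for each hyperedge $x$ choose a vertex $v_x\in x$ and let $E(x)$ consist of, for each vertex $v\ne v_x$ of multiplicity $s$ in $x$, $s$ parallel edges joining $v$ and $v_x$, together with $t-1$ loops at $v_x$, where $t$ is the multiplicity of $v_x$ in $x$ (so $|E(x)|=|x|-1$); the edge set of $\mathcal{SG}(H)$ is the disjoint union of the $E(x)$. $P(H)=(E,r_H)$ where $r_H(S)$ is the rank, in the cycle matroid of $\mathcal{SG}(H)$, of $\bigcup_{x\in S}E(x)$, i.e. the maximum size of an acyclic edge subset (loops are cycles). For a polymatroid $P=(E,r)$ with $r(\{x\})\le\mathbf a_x$ for all $x$, its $\mathbf a$-dual is $P^{*_{\mathbf a}}=(E,r^{*})$ with $r^{*}(S)=r(E-S)+\sum_{x\in S}\mathbf a_x-r(E)$. The characteristic polynomial of a polymatroid $(E,r)$ is $\chi(t)=\sum_{S\subseteq E}(-1)^{|S|}t^{r(E)-r(S)}$. $\mathcal{BG}(H)$ is the directed multigraph on $V\sqcup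 E$ with, for each hyperedge $x$ and vertex $v$ of multiplicity $s$ in $x$, $s$ edges directed from $x$ to $v$. A $\Gamma$-flow on $H$ is a map from edges of $\mathcal{BG}(H)$ to $\Gamma$ such that at every node the sum of incoming values equals the sum of outgoing values; it is nowhere-zero if for every hyperedge $x$ at least one edge incident with $x$ has nonzero value. -}

module Defs where

open import Level using (Level; _⊔_)
open import Data.Nat using (ℕ; zero; suc; _+_; _∸_; _≤_)
open import Data.Fin using (Fin; zero; suc)
open import Data.Fin.Properties using (all?; any?) renaming (_≟_ to _≟ᶠ_)
open import Data.Fin.Subset using (Subset; _∈_; _⊆_; ∣_∣; ∁; ⊤)
open import Data.Bool using (Bool; true; false; if_then_else_)
open import Data.List using (List; []; _∷_; length; lookup; removeAt; map; concatMap; allFin; filter; tabulate; sum)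
import Data.List as L
open import Data.Vec using (Vec; []; _∷_)
import Data.Vec as V
open import Data.Maybe using (Maybe; just; nothing; fromMaybe)
import Data.Maybe as M
open import Data.Product using (Σ; ∃; _×_; _,_; proj₁; proj₂)
open import Data.Sum using (_⊎_; inj₁; inj₂)
open import Data.Sum.Properties using (≡-dec)
open import Data.Integer as ℤ using (ℤ; +_)
open import Function.Definitions using (Injective)
open import Relation.Nullary using (¬_; Dec; yes; no)
open import Relation.Nullary.Decidable using (_×-dec_; ¬?)
open import Relation.Binary.PropositionalEquality using (_≡_; refl; sym; trans)
open import Algebra.Bundles using (AbelianGroup)

-- Undirected multigraphs on vertex set Fin n with N edges (edge e joins
-- the two vertices of  ends e ; a loop has equal ends).

inc : ∀ {k} → Fin k → Maybe (Fin k)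
inc {suc zero} zero = nothing
inc {suc (suc k)} zero = just (suc zero)
inc {suc (suc k)} (suc i) = M.map suc (inc i)

next : ∀ {k} → Fin (suc k) → Fin (suc k)
next i = fromMaybe zero (inc i)

Joins : ∀ {n} → Fin n × Fin n → Fin n → Fin n → Set
Joins (a , b) u w = (a ≡ u × b ≡ w) ⊎ (a ≡ w × b ≡ u)

-- A cycle: k+1 distinct edges es 0 … es k and k+1 distinct vertices
-- vs 0 … vs k such that edge es i joins vs i and vs (i+1 mod k+1).
-- (k = 0: a loop; k = 1: two parallel edges.)
record Cycle {N n : ℕ} (ends : Fin N → Fin n × Fin n) : Set where
  field
    len    : ℕ
    es     : Fin (suc len) → Fin N
    vs     : Fin (suc len) → Fin n
    es-inj : Injective _≡_ _≡_ es
    vs-inj : Injective _≡_ _≡_ vs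
    joins  : ∀ i → Joins (ends (es i)) (vs i) (vs (next i))

Acyclic : ∀ {N n} → (Fin N → Fin n × Fin n) → Subset N → Set
Acyclic ends F = (c : Cycle ends) → ¬ (∀ i → Cycle.es c i ∈ F)

IsCycleRank : ∀ {N n} → (Fin N → Fin n × Fin n) → Subset N → ℕ → Set
IsCycleRank ends T ρ =
  (Σ (Subset _) λ F → F ⊆ T × Acyclic ends F × ∣ F ∣ ≡ ρ)
  × ((F : Subset _) → F ⊆ T → Acyclic ends F → ∣ F ∣ ≤ ρ)

-- Hypergraphs: vertex set Fin n, m hyperedges; hyperedge i is the
-- multiset given by the list  hs i  (order irrelevant, repetitions =
-- multiplicities).  A choice of v_x is a position  c i  in  hs i
-- (which also forces hyperedges to be nonempty).

Hyp : ℕ → ℕ → Set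
Hyp n m = Fin m → List (Fin n)

Choice : ∀ {n m} → Hyp n m → Set
Choice {m = m} hs = (i : Fin m) → Fin (length (hs i))

-- the edges E(x_i) of SG(H), tagged with the hyperedge index:
-- for every other element w of x_i (other copies of v_x included) an
-- edge joining w and v_x (a loop when w = v_x).
sgEdgesOf : ∀ {n m} (hs : Hyp n m) → Choice hs → Fin m → List (Fin m × (Fin n × Fin n))
sgEdgesOf hs c i = map (λ w → i , (w , lookup (hs i) (c i))) (removeAt (hs i) (c i))

sgEdges : ∀ {n m} (hs : Hyp n m) → Choice hs → List (Fin m × (Fin n × Fin n))
sgEdges {m = m} hs c = concatMap (sgEdgesOf hs c) (allFin m)

sgEnds : ∀ {n m} (hs : Hyp n m) (c : Choice hs) → Fin (length (sgEdges hs c)) → Fin n × Fin n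
sgEnds hs c e = proj₂ (lookup (sgEdges hs c) e)

sgSub : ∀ {n m} (hs : Hyp n m) (c : Choice hs) → Subset m → Subset (length (sgEdges hs c))
sgSub hs c S = V.tabulate (λ e → V.lookup S (proj₁ (lookup (sgEdges hs c) e)))

IsRankPH : ∀ {n m} (hs : Hyp n m) → Choice hs → (Subset m → ℕ) → Set
IsRankPH {m = m} hs c r = (S : Subset m) → IsCycleRank (sgEnds hs c) (sgSub hs c S) (r S)

aVec : ∀ {n m} → Hyp n m → Fin m → ℕ
aVec hs i = length (hs i) ∸ 1

sumOver : ∀ {m} → Subset m → (Fin m → ℕ) → ℕ
sumOver {zero} [] f = 0
sumOver {suc m} (true ∷ S) f = f zero + sumOver S (λ i → f (suc i))
sumOver {suc m} (false ∷ S) f = sumOver S (λ i → f (suc i))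

-- the a-dual rank  r*(S) = r(E - S) + Σ_{x∈S} a_x - r(E)
-- (the truncated subtraction never truncates for a polymatroid rank
-- function with r({x}) ≤ a_x)
dualRank : ∀ {m} → (Subset m → ℕ) → (Fin m → ℕ) → Subset m → ℕ
dualRank r a S = (r (∁ S) + sumOver S a) ∸ r ⊤

allVecs : ∀ {A : Set} → List A → (N : ℕ) → List (Vec A N)
allVecs xs zero = [] ∷ []
allVecs xs (suc N) = concatMap (λ x → map (x ∷_) (allVecs xs N)) xs

charPoly : ∀ {m} → (Subset m → ℕ) → ℕ → ℤ
charPoly {m} ρ t =
  L.foldr ℤ._+_ (+ 0)
    (map (λ S → (ℤ.- (+ 1)) ℤ.^ ∣ S ∣ ℤ.* (+ (t Data.Nat.^ (ρ ⊤ ∸ ρ S))))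
         (allVecs (true ∷ false ∷ []) m))

record FiniteEnum {c ℓ} (G : AbelianGroup c ℓ) : Set (c ⊔ ℓ) where
  open AbelianGroup G
  field
    size : ℕ
    enum : Fin size → Carrier
    enum-inj : ∀ i j → enum i ≈ enum j → i ≡ j
    enum-surj : ∀ g → Σ (Fin size) λ i → enum i ≈ g

  _≈?_ : ∀ g h → Dec (g ≈ h)
  g ≈? h with enum-surj g | enum-surj h
  ... | i , p | j , q with i ≟ᶠ j
  ...   | yes refl = yes (trans′ (sym′ p) q)
    where open AbelianGroup G using () renaming (sym to sym′; trans to trans′)
  ...   | no i≢j = no λ g≈h → i≢j (enum-inj i j (trans′ p (trans′ g≈h (sym′ q))))
    where open AbelianGroup G using () renaming (sym to sym′; trans to trans′)

-- Flows on the bipartite digraph BG(H): nodes Fin n ⊎ Fin m (vertices,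
-- hyperedges); for each hyperedge i and each element w of the list hs i
-- (so with multiplicity) one edge directed from hyperedge i to vertex w.

bgEdges : ∀ {n m} → Hyp n m → List (Fin m × Fin n)
bgEdges {m = m} hs = concatMap (λ i → map (i ,_) (hs i)) (allFin m)

module _ {c ℓ} (G : AbelianGroup c ℓ) (FG : FiniteEnum G) where
  open AbelianGroup G
  open FiniteEnum FG

  sumG : ∀ {N} → (Fin N → Carrier) → Carrier
  sumG {zero} f = ε
  sumG {suc N} f = f zero ∙ sumG (λ i → f (suc i))

  module _ {n m} (hs : Hyp n m) where
    NB : ℕ
    NB = length (bgEdges hs)

    tail head : Fin NB → Fin n ⊎ Fin m
    tail e = inj₂ (proj₁ (lookup (bgEdges hs) e))
    head e = inj₁ (proj₂ (lookup (bgEdges hs) e))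

    node? : (u w : Fin n ⊎ Fin m) → Dec (u ≡ w)
    node? = ≡-dec _≟ᶠ_ _≟ᶠ_

    inflow outflow : (Fin NB → Carrier) → Fin n ⊎ Fin m → Carrier
    inflow f u = sumG (λ e → if Relation.Nullary.does (node? (head e) u) then f e else ε)
    outflow f u = sumG (λ e → if Relation.Nullary.does (node? (tail e) u) then f e else ε)

    IsFlow : (Fin NB → Carrier) → Set ℓ
    IsFlow f = ∀ u → inflow f u ≈ outflow f u

    NowhereZero : (Fin NB → Carrier) → Set ℓ
    NowhereZero f = ∀ (i : Fin m) → ∃ λ e → tail e ≡ inj₂ i × ¬ (f e ≈ ε)

    IsNZFlow : (Fin NB → Carrier) → Set ℓ
    IsNZFlow f = IsFlow f × NowhereZero f

    private
      allSum? : ∀ {p} {P : Fin n ⊎ Fin m → Set p} → (∀ u → Dec (P u)) → Dec (∀ u → P u)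
      allSum? P? with all? (λ v → P? (inj₁ v)) | all? (λ i → P? (inj₂ i))
      ... | yes a | yes b = yes λ { (inj₁ v) → a v ; (inj₂ i) → b i }
      ... | no ¬a | _ = no λ h → ¬a (λ v → h (inj₁ v))
      ... | yes _ | no ¬b = no λ h → ¬b (λ i → h (inj₂ i))

    isNZFlow? : ∀ f → Dec (IsNZFlow f)
    isNZFlow? f = allSum? (λ u → inflow f u ≈? outflow f u)
                  ×-dec all? (λ i → any? (λ e → node? (tail e) (inj₂ i) ×-dec ¬? (f e ≈? ε)))

    -- number of nowhere-zero Γ-flows (maps counted up to ≈, via the
    -- enumeration of Γ)
    numNZFlows : ℕ
    numNZFlows = length (filter (λ F → isNZFlow? (λ e → enum (V.lookup F e)))
                                (allVecs (allFin size) NB))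

module Submission where

-- A nowhere-zero flow on BG(H) is determined by its values on the edges of SG(H): the edge from
-- a hyperedge x to the chosen vertex v_x must carry minus the sum of the other edges at x, and the
-- balance conditions at the vertices of BG(H) then become those of SG(H). So we count flows on SG(H)
-- that do not vanish on any block E(x). Inclusion–exclusion over the set T of hyperedges on which the
-- flow is forced to vanish gives Σ_T (-1)^|T| times the number of flows supported on A = ⋃_{x∉T} E(x),
-- and a graph has |Γ|^(|A| - rank A) flows supported on A: each edge outside a maximal forest of A
-- closes a cycle, along which any value can be pushed, while a flow supported on a forest is zero.
-- Finally |A| - r(E - T) = r*(E) - r*(T).

module Counting where

  open import Algebra.Bundles using (CommutativeMonoid)
  open import Data.Nat using (ℕ; zero; suc; _+_; _*_)
  open import Data.Nat.Properties using (+-0-commutativeMonoid; +-*-semiring; *-assoc; +-identityʳ)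
  open import Data.Fin using (Fin; zero; suc; _≟_; toℕ)
  open import Data.Fin.Properties using (suc-injective; all?)
  open import Data.Vec using (Vec; []; _∷_; lookup)
  open import Data.Vec.Properties using (∷-injective)
  import Data.Vec.Properties as Vec
  open import Data.List using (List; []; _∷_; _++_; map; length; removeAt; allFin; filter; concatMap; tabulate)
  import Data.List as List
  open import Data.Product using (_×_; _,_; proj₁)
  open import Relation.Nullary using (¬_; Dec; yes; no; does)
  open import Relation.Nullary.Decidable using (_×-dec_)
  open import Relation.Binary.PropositionalEquality using (_≡_; _≢_; refl; sym; trans; cong; cong₂; module ≡-Reasoning)
  open import Data.Empty using (⊥-elim)
  open import Data.Bool using (true; false)
  open import Data.List.Properties using (filter-++; length-++)
  open import Function using (_∘_)
  open import Data.Vec.Functional using () renaming ([] to []ᶠ; _∷_ to _∷ᶠ_)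
  open import Defs using (allVecs)

  module MonoidSum {c ℓ} (M : CommutativeMonoid c ℓ) where
    open CommutativeMonoid M using (Carrier; _≈_; _∙_; ε; ∙-congˡ; ∙-congʳ; identityˡ; identityʳ; setoid)
    open import Algebra.Properties.CommutativeMonoid.Sum M
    open import Relation.Binary.Reasoning.Setoid setoid

    sum-single : ∀ {n} (j : Fin n) (f : Fin n → Carrier) → (∀ i → i ≢ j → f i ≈ ε) → sum f ≈ f j
    sum-single {suc n} zero f f≈ε = begin
      f zero ∙ sum (λ i → f (suc i)) ≈⟨ ∙-congˡ (CommutativeMonoid.trans M (sum-cong-≋ {n} (λ i → f≈ε (suc i) λ ())) (sum-replicate-zero n)) ⟩
      f zero ∙ ε                     ≈⟨ identityʳ (f zero) ⟩
      f zero                         ∎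
    sum-single (suc j) f f≈ε = begin
      f zero ∙ sum (λ i → f (suc i)) ≈⟨ ∙-congʳ (f≈ε zero λ ()) ⟩
      ε ∙ sum (λ i → f (suc i))      ≈⟨ identityˡ _ ⟩
      sum (λ i → f (suc i))          ≈⟨ sum-single j (λ i → f (suc i)) (λ i i≢j → f≈ε (suc i) (i≢j ∘ suc-injective)) ⟩
      f (suc j)                      ∎

  𝟙 : ∀ {p} {P : Set p} → Dec P → ℕ
  𝟙 (yes _) = 1
  𝟙 (no _)  = 0

  𝟙-cong : ∀ {p q} {P : Set p} {Q : Set q} → (P → Q) → (Q → P) → (P? : Dec P) (Q? : Dec Q) → 𝟙 P? ≡ 𝟙 Q?
  𝟙-cong _ _ (yes _) (yes _) = refl
  𝟙-cong f _ (yes p) (no ¬q) = ⊥-elim (¬q (f p))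
  𝟙-cong _ g (no ¬p) (yes q) = ⊥-elim (¬p (g q))
  𝟙-cong _ _ (no _)  (no _)  = refl

  𝟙-× : ∀ {p q} {P : Set p} {Q : Set q} (P? : Dec P) (Q? : Dec Q) → 𝟙 (P? ×-dec Q?) ≡ 𝟙 P? * 𝟙 Q?
  𝟙-× (yes _) (yes _) = refl
  𝟙-× (yes _) (no _)  = refl
  𝟙-× (no _)  _       = refl

  𝟙-yes : ∀ {p} {P : Set p} (P? : Dec P) → P → 𝟙 P? ≡ 1
  𝟙-yes (yes _) _ = refl
  𝟙-yes (no ¬p) p = ⊥-elim (¬p p)

  𝟙-no : ∀ {p} {P : Set p} (P? : Dec P) → ¬ P → 𝟙 P? ≡ 0
  𝟙-no (yes p) ¬p = ⊥-elim (¬p p)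
  𝟙-no (no _)  _  = refl

  open import Algebra.Properties.CommutativeMonoid.Sum +-0-commutativeMonoid public
    using (sum; sum-syntax; ∑-comm; ∑-distrib-+; ∑-permute)
    renaming (sum-cong-≗ to ∑-cong)
  open import Algebra.Properties.Semiring.Sum +-*-semiring using (*-distribˡ-sum)
  open MonoidSum +-0-commutativeMonoid using (sum-single)

  ∑-const : ∀ n c → ∑[ i < n ] c ≡ n * c
  ∑-const zero    c = refl
  ∑-const (suc n) c = cong (c +_) (∑-const n c)

  ∑-*ˡ : ∀ {n} c (f : Fin n → ℕ) → ∑[ i < n ] (c * f i) ≡ c * ∑[ i < n ] f i
  ∑-*ˡ c f = sym (*-distribˡ-sum c f)

  ∑-δ : ∀ {n} (j : Fin n) (f : Fin n → ℕ) → ∑[ i < n ] (𝟙 (i ≟ j) * f i) ≡ f j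
  ∑-δ j f = trans (sum-single j _ λ i i≢j → cong (_* f i) (𝟙-no (i ≟ j) i≢j))
                  (trans (cong (_* f j) (𝟙-yes (j ≟ j) refl)) (+-identityʳ (f j)))

  concatBlocks : ∀ {X : Set} k → (Fin k → List X) → List X
  concatBlocks zero    rs = []
  concatBlocks (suc k) rs = rs zero ++ concatBlocks k (λ j → rs (suc j))

  concatBlocks-cong : ∀ {X : Set} k {rs rs′ : Fin k → List X} → (∀ j → rs j ≡ rs′ j) → concatBlocks k rs ≡ concatBlocks k rs′
  concatBlocks-cong zero    rs≡rs′ = refl
  concatBlocks-cong (suc k) rs≡rs′ = cong₂ _++_ (rs≡rs′ zero) (concatBlocks-cong k (rs≡rs′ ∘ suc))

  concatMap-tabulate : ∀ {X Y : Set} {k} (f : Y → List X) (g : Fin k → Y) → concatMap f (tabulate g) ≡ concatBlocks k (λ j → f (g j))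
  concatMap-tabulate {k = zero}  f g = refl
  concatMap-tabulate {k = suc k} f g = cong (f (g zero) ++_) (concatMap-tabulate f (λ j → g (suc j)))

  module _ {X : Set} {p} {P : X → Set p} (P? : ∀ x → Dec (P x)) where

    length-filter-concatBlocks : ∀ k (rs : Fin k → List X) → length (filter P? (concatBlocks k rs)) ≡ ∑[ j < k ] length (filter P? (rs j))
    length-filter-concatBlocks zero    rs = refl
    length-filter-concatBlocks (suc k) rs = begin
      length (filter P? (rs zero ++ concatBlocks k (λ j → rs (suc j))))
        ≡⟨ cong length (filter-++ P? (rs zero) _) ⟩
      length (filter P? (rs zero) ++ filter P? (concatBlocks k (λ j → rs (suc j))))
        ≡⟨ length-++ (filter P? (rs zero)) ⟩
      length (filter P? (rs zero)) + length (filter P? (concatBlocks k (λ j → rs (suc j))))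
        ≡⟨ cong (length (filter P? (rs zero)) +_) (length-filter-concatBlocks k (λ j → rs (suc j))) ⟩
      ∑[ j < suc k ] length (filter P? (rs j)) ∎
      where open ≡-Reasoning

    length-filter-map : ∀ {Y : Set} (g : Y → X) (ys : List Y) → length (filter P? (map g ys)) ≡ length (filter (λ y → P? (g y)) ys)
    length-filter-map g []       = refl
    length-filter-map g (y ∷ ys) with does (P? (g y))
    ... | true  = cong suc (length-filter-map g ys)
    ... | false = length-filter-map g ys

  -- inserts at position k, or at the end when k is out of range
  insertAt′ : ∀ {B : Set} → ℕ → B → List B → List B
  insertAt′ zero    b r       = b ∷ r
  insertAt′ (suc k) b []      = b ∷ []
  insertAt′ (suc k) b (y ∷ r) = y ∷ insertAt′ k b r

  module SumsOver (s : ℕ) where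

    ∑ᵛ : ∀ N → (Vec (Fin s) N → ℕ) → ℕ
    ∑ᵛ zero    f = f []
    ∑ᵛ (suc N) f = ∑[ x < s ] ∑ᵛ N (λ v → f (x ∷ v))

    ∑ᵛ-cong : ∀ N {f g : Vec (Fin s) N → ℕ} → (∀ v → f v ≡ g v) → ∑ᵛ N f ≡ ∑ᵛ N g
    ∑ᵛ-cong zero    f≡g = f≡g []
    ∑ᵛ-cong (suc N) f≡g = ∑-cong (λ x → ∑ᵛ-cong N (λ v → f≡g (x ∷ v)))

    ∑ᵛ-∑ : ∀ N {k} (f : Fin k → Vec (Fin s) N → ℕ) → ∑ᵛ N (λ v → ∑[ j < k ] f j v) ≡ ∑[ j < k ] ∑ᵛ N (f j)
    ∑ᵛ-∑ zero    f = refl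
    ∑ᵛ-∑ (suc N) f = trans (∑-cong (λ x → ∑ᵛ-∑ N (λ j v → f j (x ∷ v)))) (∑-comm (λ x j → ∑ᵛ N (λ v → f j (x ∷ v))))

    ∑ᵛ-*ˡ : ∀ N c (f : Vec (Fin s) N → ℕ) → ∑ᵛ N (λ v → c * f v) ≡ c * ∑ᵛ N f
    ∑ᵛ-*ˡ zero    c f = refl
    ∑ᵛ-*ˡ (suc N) c f = trans (∑-cong (λ x → ∑ᵛ-*ˡ N c (λ v → f (x ∷ v)))) (∑-*ˡ c (λ x → ∑ᵛ N (λ v → f (x ∷ v))))

    ∑ᵛ-splitAt : ∀ N (e : Fin N) (f : Vec (Fin s) N → ℕ) → ∑ᵛ N f ≡ ∑[ g < s ] ∑ᵛ N (λ v → 𝟙 (g ≟ lookup v e) * f v)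
    ∑ᵛ-splitAt N e f = trans (∑ᵛ-cong N (λ v → sym (∑-δ (lookup v e) (λ _ → f v)))) (∑ᵛ-∑ N (λ g v → 𝟙 (g ≟ lookup v e) * f v))

    ∑ᵛ-δ : ∀ N (w : Vec (Fin s) N) (f : Vec (Fin s) N → ℕ) → ∑ᵛ N (λ v → 𝟙 (Vec.≡-dec _≟_ v w) * f v) ≡ f w
    ∑ᵛ-δ zero    []      f = +-identityʳ (f [])
    ∑ᵛ-δ (suc N) (y ∷ w) f =
      trans (∑-cong {s} split) (trans (∑-δ y (λ x → ∑ᵛ N (λ v → 𝟙 (Vec.≡-dec _≟_ v w) * f (x ∷ v)))) (∑ᵛ-δ N w (λ v → f (y ∷ v))))
      where
      split : ∀ x → ∑ᵛ N (λ v → 𝟙 (Vec.≡-dec _≟_ (x ∷ v) (y ∷ w)) * f (x ∷ v))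
                  ≡ 𝟙 (x ≟ y) * ∑ᵛ N (λ v → 𝟙 (Vec.≡-dec _≟_ v w) * f (x ∷ v))
      split x = trans (∑ᵛ-cong N λ v → trans
                        (cong (_* f (x ∷ v)) (trans (𝟙-cong ∷-injective (λ (p , q) → cong₂ _∷_ p q)
                                                            (Vec.≡-dec _≟_ (x ∷ v) (y ∷ w)) (x ≟ y ×-dec Vec.≡-dec _≟_ v w))
                                                    (𝟙-× (x ≟ y) (Vec.≡-dec _≟_ v w))))
                        (*-assoc (𝟙 (x ≟ y)) _ _))
                      (∑ᵛ-*ˡ N (𝟙 (x ≟ y)) (λ v → 𝟙 (Vec.≡-dec _≟_ v w) * f (x ∷ v)))

    count-allVecs : ∀ N {p} {P : Vec (Fin s) N → Set p} (P? : ∀ v → Dec (P v)) →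
                    length (filter P? (allVecs (allFin s) N)) ≡ ∑ᵛ N (λ v → 𝟙 (P? v))
    count-allVecs zero    P? with P? []
    ... | yes _ = refl
    ... | no _  = refl
    count-allVecs (suc N) P? = begin
      length (filter P? (concatMap (λ x → map (x ∷_) (allVecs (allFin s) N)) (allFin s)))
        ≡⟨ cong (length ∘ filter P?) (concatMap-tabulate (λ x → map (x ∷_) (allVecs (allFin s) N)) (λ x → x)) ⟩
      length (filter P? (concatBlocks s (λ x → map (x ∷_) (allVecs (allFin s) N))))
        ≡⟨ length-filter-concatBlocks P? s (λ x → map (x ∷_) (allVecs (allFin s) N)) ⟩
      ∑[ x < s ] length (filter P? (map (x ∷_) (allVecs (allFin s) N)))
        ≡⟨ ∑-cong {s} (λ x → trans (length-filter-map P? (x ∷_) (allVecs (allFin s) N)) (count-allVecs N (λ v → P? (x ∷ v)))) ⟩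
      ∑ᵛ (suc N) (λ v → 𝟙 (P? v)) ∎
      where open ≡-Reasoning

    module _ {X : Set} where

      ∑ˡ : (L : List X) → (List (X × Fin s) → ℕ) → ℕ
      ∑ˡ []      f = f []
      ∑ˡ (x ∷ L) f = ∑[ a < s ] ∑ˡ L (λ r → f ((x , a) ∷ r))

      zipLabels : (L : List X) → Vec (Fin s) (length L) → List (X × Fin s)
      zipLabels []      []      = []
      zipLabels (x ∷ L) (a ∷ v) = (x , a) ∷ zipLabels L v

      ∑ᵛ-zipLabels : ∀ (L : List X) (g : List (X × Fin s) → ℕ) → ∑ᵛ (length L) (λ v → g (zipLabels L v)) ≡ ∑ˡ L g
      ∑ᵛ-zipLabels []      g = refl
      ∑ᵛ-zipLabels (x ∷ L) g = ∑-cong {s} (λ a → ∑ᵛ-zipLabels L (λ r → g ((x , a) ∷ r)))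

      ∑ˡ-cong : ∀ (L : List X) {f g : List (X × Fin s) → ℕ} → (∀ r → map proj₁ r ≡ L → f r ≡ g r) → ∑ˡ L f ≡ ∑ˡ L g
      ∑ˡ-cong []      f≡g = f≡g [] refl
      ∑ˡ-cong (x ∷ L) f≡g = ∑-cong {s} (λ a → ∑ˡ-cong L (λ r labels → f≡g ((x , a) ∷ r) (cong (x ∷_) labels)))

      ∑ˡ-+ : ∀ (L : List X) (f g : List (X × Fin s) → ℕ) → ∑ˡ L (λ r → f r + g r) ≡ ∑ˡ L f + ∑ˡ L g
      ∑ˡ-+ []      f g = refl
      ∑ˡ-+ (x ∷ L) f g = trans (∑-cong {s} (λ a → ∑ˡ-+ L (λ r → f ((x , a) ∷ r)) (λ r → g ((x , a) ∷ r))))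
                               (∑-distrib-+ (λ a → ∑ˡ L (λ r → f ((x , a) ∷ r))) (λ a → ∑ˡ L (λ r → g ((x , a) ∷ r))))

      ∑ˡ-∑ : ∀ (L : List X) {k} (f : Fin k → List (X × Fin s) → ℕ) → ∑ˡ L (λ r → ∑[ j < k ] f j r) ≡ ∑[ j < k ] ∑ˡ L (f j)
      ∑ˡ-∑ []      f = refl
      ∑ˡ-∑ (x ∷ L) f = trans (∑-cong {s} (λ a → ∑ˡ-∑ L (λ j r → f j ((x , a) ∷ r))))
                             (∑-comm (λ a j → ∑ˡ L (λ r → f j ((x , a) ∷ r))))

      ∑ˡ-*ˡ : ∀ (L : List X) c (f : List (X × Fin s) → ℕ) → ∑ˡ L (λ r → c * f r) ≡ c * ∑ˡ L f
      ∑ˡ-*ˡ []      c f = refl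
      ∑ˡ-*ˡ (x ∷ L) c f = trans (∑-cong {s} (λ a → ∑ˡ-*ˡ L c (λ r → f ((x , a) ∷ r))))
                                (∑-*ˡ c (λ a → ∑ˡ L (λ r → f ((x , a) ∷ r))))

      ∑ˡ-++ : ∀ (L₁ L₂ : List X) (g : List (X × Fin s) → ℕ) →
              ∑ˡ (L₁ ++ L₂) g ≡ ∑ˡ L₁ (λ r₁ → ∑ˡ L₂ (λ r₂ → g (r₁ ++ r₂)))
      ∑ˡ-++ []       L₂ g = refl
      ∑ˡ-++ (x ∷ L₁) L₂ g = ∑-cong {s} (λ a → ∑ˡ-++ L₁ L₂ (λ r → g ((x , a) ∷ r)))

      ∑ˡ-removeAt : ∀ (L : List X) (p : Fin (length L)) (g : List (X × Fin s) → ℕ) →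
                    ∑ˡ L g ≡ ∑[ a < s ] ∑ˡ (removeAt L p) (λ r → g (insertAt′ (toℕ p) (List.lookup L p , a) r))
      ∑ˡ-removeAt (x ∷ L) zero    g = refl
      ∑ˡ-removeAt (x ∷ L) (suc p) g = trans (∑-cong {s} (λ b → ∑ˡ-removeAt L p (λ r → g ((x , b) ∷ r))))
        (∑-comm (λ b a → ∑ˡ (removeAt L p) (λ r → g ((x , b) ∷ insertAt′ (toℕ p) (List.lookup L p , a) r))))

    relabel : ∀ {X Y A : Set} → (X → Y) → List (X × A) → List (Y × A)
    relabel h = map (λ (x , a) → h x , a)

    ∑ˡ-map : ∀ {X Y : Set} (h : X → Y) (L : List X) (g : List (Y × Fin s) → ℕ) → ∑ˡ (map h L) g ≡ ∑ˡ L (λ r → g (relabel h r))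
    ∑ˡ-map h []      g = refl
    ∑ˡ-map h (x ∷ L) g = ∑-cong {s} (λ a → ∑ˡ-map h L (λ r → g ((h x , a) ∷ r)))

    module _ {X : Set} where

      ∑ᴮ : ∀ m (B : Fin m → List X) → ((Fin m → List (X × Fin s)) → ℕ) → ℕ
      ∑ᴮ zero    B G = G []ᶠ
      ∑ᴮ (suc m) B G = ∑ˡ (B zero) (λ r → ∑ᴮ m (B ∘ suc) (λ rs → G (r ∷ᶠ rs)))

      ∑ˡ-concatBlocks : ∀ m (B : Fin m → List X) (g : List (X × Fin s) → ℕ) →
                        ∑ˡ (concatBlocks m B) g ≡ ∑ᴮ m B (λ rs → g (concatBlocks m rs))
      ∑ˡ-concatBlocks zero    B g = refl
      ∑ˡ-concatBlocks (suc m) B g = trans (∑ˡ-++ (B zero) (concatBlocks m (B ∘ suc)) g)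
                                          (∑ˡ-cong (B zero) (λ r _ → ∑ˡ-concatBlocks m (B ∘ suc) (λ r₂ → g (r ++ r₂))))

      ∑ᴮ-cong : ∀ m (B : Fin m → List X) {f g : (Fin m → List (X × Fin s)) → ℕ} →
                (∀ rs → (∀ j → map proj₁ (rs j) ≡ B j) → f rs ≡ g rs) → ∑ᴮ m B f ≡ ∑ᴮ m B g
      ∑ᴮ-cong zero    B f≡g = f≡g []ᶠ (λ ())
      ∑ᴮ-cong (suc m) B f≡g = ∑ˡ-cong (B zero) λ r r-labels → ∑ᴮ-cong m (B ∘ suc) λ rs rs-labels →
                                f≡g (r ∷ᶠ rs) λ { zero → r-labels ; (suc j) → rs-labels j }

      ∑ᴮ-*ˡ : ∀ m (B : Fin m → List X) c (f : (Fin m → List (X × Fin s)) → ℕ) → ∑ᴮ m B (λ rs → c * f rs) ≡ c * ∑ᴮ m B f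
      ∑ᴮ-*ˡ zero    B c f = refl
      ∑ᴮ-*ˡ (suc m) B c f = trans (∑ˡ-cong (B zero) (λ r _ → ∑ᴮ-*ˡ m (B ∘ suc) c (λ rs → f (r ∷ᶠ rs))))
                                  (∑ˡ-*ˡ (B zero) c (λ r → ∑ᴮ m (B ∘ suc) (λ rs → f (r ∷ᶠ rs))))

    Extensional : ∀ {m} {Y : Set} → ((Fin m → Y) → ℕ) → Set
    Extensional {m} G = ∀ rs rs′ → (∀ j → rs j ≡ rs′ j) → G rs ≡ G rs′

    module _ {X Y : Set} {H : List (X × Fin s) → Set} (H? : ∀ r → Dec (H r)) where

      ∑ᴮ-reparametrise : ∀ m (B : Fin m → List X) (C : Fin m → List Y) (Φ : Fin m → List (Y × Fin s) → List (X × Fin s)) →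
        (∀ j (g : List (X × Fin s) → ℕ) → ∑ˡ (B j) (λ r → 𝟙 (H? r) * g r) ≡ ∑ˡ (C j) (λ r → g (Φ j r))) →
        (G : (Fin m → List (X × Fin s)) → ℕ) → Extensional G →
        ∑ᴮ m B (λ rs → 𝟙 (all? (λ j → H? (rs j))) * G rs) ≡ ∑ᴮ m C (λ rs → G (λ j → Φ j (rs j)))
      ∑ᴮ-reparametrise zero B C Φ Φ-valid G G-ext =
        trans (cong (_* G []ᶠ) (𝟙-yes (all? {n = 0} (λ j → H? ([]ᶠ j))) (λ ()))) (trans (+-identityʳ (G []ᶠ)) (G-ext _ _ (λ ())))
      ∑ᴮ-reparametrise (suc m) B C Φ Φ-valid G G-ext = begin
        ∑ˡ (B zero) (λ r → ∑ᴮ m (B ∘ suc) (λ rs → 𝟙 (all? (λ j → H? ((r ∷ᶠ rs) j))) * G (r ∷ᶠ rs)))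
          ≡⟨ ∑ˡ-cong (B zero) (λ r _ → trans (∑ᴮ-cong m (B ∘ suc) (λ rs _ → split r rs))
                                              (∑ᴮ-*ˡ m (B ∘ suc) (𝟙 (H? r)) (λ rs → 𝟙 (all? (λ j → H? (rs j))) * G (r ∷ᶠ rs)))) ⟩
        ∑ˡ (B zero) (λ r → 𝟙 (H? r) * ∑ᴮ m (B ∘ suc) (λ rs → 𝟙 (all? (λ j → H? (rs j))) * G (r ∷ᶠ rs)))
          ≡⟨ Φ-valid zero _ ⟩
        ∑ˡ (C zero) (λ r → ∑ᴮ m (B ∘ suc) (λ rs → 𝟙 (all? (λ j → H? (rs j))) * G (Φ zero r ∷ᶠ rs)))
          ≡⟨ ∑ˡ-cong (C zero) (λ r _ → ∑ᴮ-reparametrise m (B ∘ suc) (C ∘ suc) (Φ ∘ suc) (Φ-valid ∘ suc) (λ rs → G (Φ zero r ∷ᶠ rs))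
                                          (λ rs rs′ rs≡rs′ → G-ext _ _ λ { zero → refl ; (suc j) → rs≡rs′ j })) ⟩
        ∑ˡ (C zero) (λ r → ∑ᴮ m (C ∘ suc) (λ rs → G (Φ zero r ∷ᶠ (λ j → Φ (suc j) (rs j)))))
          ≡⟨ ∑ˡ-cong (C zero) (λ r _ → ∑ᴮ-cong m (C ∘ suc) λ rs _ → G-ext _ _ λ { zero → refl ; (suc j) → refl }) ⟩
        ∑ᴮ (suc m) C (λ rs → G (λ j → Φ j (rs j))) ∎
        where
        open ≡-Reasoning
        split : ∀ r rs → 𝟙 (all? (λ j → H? ((r ∷ᶠ rs) j))) * G (r ∷ᶠ rs) ≡ 𝟙 (H? r) * (𝟙 (all? (λ j → H? (rs j))) * G (r ∷ᶠ rs))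
        split r rs = trans (cong (_* G (r ∷ᶠ rs)) (trans (𝟙-cong (λ H-all → H-all zero , H-all ∘ suc)
                                                                 (λ { (H-r , H-rs) zero → H-r ; (H-r , H-rs) (suc j) → H-rs j })
                                                                 (all? (λ j → H? ((r ∷ᶠ rs) j))) (H? r ×-dec all? (λ j → H? (rs j))))
                                                         (𝟙-× (H? r) (all? (λ j → H? (rs j))))))
                           (*-assoc (𝟙 (H? r)) _ _)

module InclusionExclusion where

  open import Data.Nat as ℕ using (ℕ; zero; suc)
  open import Data.Integer using (ℤ; +_; -_; _+_; _*_; _^_)
  import Data.Integer.Properties as ℤ
  open import Algebra.Properties.Ring ℤ.+-*-ring using (-1*x≈-x)
  open import Data.Fin using (Fin; zero; suc)
  open import Data.Fin.Properties using (all?)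
  open import Data.Fin.Subset using (Subset; _∈_; ∣_∣)
  open import Data.Fin.Subset.Properties using (_∈?_)
  open import Data.Vec using ([]; _∷_; here; there)
  open import Data.Bool using (true; false)
  open import Data.List using (List; []; _∷_; _++_; map; foldr)
  open import Data.Product using (_×_; _,_)
  open import Relation.Nullary using (¬_; Dec; yes; no)
  open import Relation.Nullary.Decidable using (_×-dec_; ¬?; _→-dec_)
  open import Function using (_∘_)
  open import Relation.Binary.PropositionalEquality using (_≡_; refl; sym; trans; cong; cong₂; module ≡-Reasoning)
  open import Defs using (allVecs)
  open Counting using (𝟙; 𝟙-cong)

  ∑ℤ : ∀ {Y : Set} → List Y → (Y → ℤ) → ℤ
  ∑ℤ ys f = foldr _+_ (+ 0) (map f ys)

  ∑ℤ-cong : ∀ {Y : Set} (ys : List Y) {f g : Y → ℤ} → (∀ y → f y ≡ g y) → ∑ℤ ys f ≡ ∑ℤ ys g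
  ∑ℤ-cong []       f≡g = refl
  ∑ℤ-cong (y ∷ ys) f≡g = cong₂ _+_ (f≡g y) (∑ℤ-cong ys f≡g)

  ∑ℤ-++ : ∀ {Y : Set} (xs ys : List Y) f → ∑ℤ (xs ++ ys) f ≡ ∑ℤ xs f + ∑ℤ ys f
  ∑ℤ-++ []       ys f = sym (ℤ.+-identityˡ _)
  ∑ℤ-++ (x ∷ xs) ys f = trans (cong (λ z → f x + z) (∑ℤ-++ xs ys f)) (sym (ℤ.+-assoc (f x) _ _))

  ∑ℤ-map : ∀ {X Y : Set} (g : X → Y) (xs : List X) f → ∑ℤ (map g xs) f ≡ ∑ℤ xs (λ x → f (g x))
  ∑ℤ-map g []       f = refl
  ∑ℤ-map g (x ∷ xs) f = cong (λ z → f (g x) + z) (∑ℤ-map g xs f)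

  ∑ℤ-neg : ∀ {Y : Set} (ys : List Y) f → ∑ℤ ys (λ y → - f y) ≡ - ∑ℤ ys f
  ∑ℤ-neg []       f = refl
  ∑ℤ-neg (y ∷ ys) f = trans (cong (λ z → - f y + z) (∑ℤ-neg ys f)) (sym (ℤ.neg-distrib-+ (f y) _))

  subsets : ∀ k → List (Subset k)
  subsets = allVecs (true ∷ false ∷ [])

  ∑ℤ-subsets-suc : ∀ k (F : Subset (suc k) → ℤ) →
                   ∑ℤ (subsets (suc k)) F ≡ ∑ℤ (subsets k) (λ T → F (true ∷ T)) + ∑ℤ (subsets k) (λ T → F (false ∷ T))
  ∑ℤ-subsets-suc k F = begin
    ∑ℤ (map (true ∷_) (subsets k) ++ map (false ∷_) (subsets k) ++ []) F
      ≡⟨ ∑ℤ-++ (map (true ∷_) (subsets k)) _ F ⟩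
    ∑ℤ (map (true ∷_) (subsets k)) F + ∑ℤ (map (false ∷_) (subsets k) ++ []) F
      ≡⟨ cong₂ _+_ (∑ℤ-map (true ∷_) (subsets k) F)
                     (trans (∑ℤ-++ (map (false ∷_) (subsets k)) [] F) (trans (ℤ.+-identityʳ _) (∑ℤ-map (false ∷_) (subsets k) F))) ⟩
    ∑ℤ (subsets k) (λ T → F (true ∷ T)) + ∑ℤ (subsets k) (λ T → F (false ∷ T)) ∎
    where open ≡-Reasoning

  sgn : ℕ → ℤ
  sgn k = (- (+ 1)) ^ k

  sgn-suc : ∀ k c → sgn (suc k) * c ≡ - (sgn k * c)
  sgn-suc k c = trans (ℤ.*-assoc (- (+ 1)) (sgn k) c) (-1*x≈-x (sgn k * c))

  AllIn : ∀ {k} {R : Set} → Subset k → (Fin k → R → Set) → R → Set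
  AllIn T Z r = ∀ i → i ∈ T → Z i r

  allIn? : ∀ {k} {R : Set} (T : Subset k) {Z : Fin k → R → Set} → (∀ i r → Dec (Z i r)) → ∀ r → Dec (AllIn T Z r)
  allIn? T Z? r = all? (λ i → (i ∈? T) →-dec Z? i r)

  module _ {R : Set} (sumR : (R → ℕ) → ℕ)
           (sumR-cong : ∀ {f g} → (∀ r → f r ≡ g r) → sumR f ≡ sumR g)
           (sumR-+ : ∀ f g → sumR (λ r → f r ℕ.+ g r) ≡ sumR f ℕ.+ sumR g) where

    #allIn : ∀ {k} (T : Subset k) {Q : R → Set} (Q? : ∀ r → Dec (Q r)) {Z : Fin k → R → Set} (Z? : ∀ i r → Dec (Z i r)) → ℕ
    #allIn T Q? Z? = sumR (λ r → 𝟙 (Q? r ×-dec allIn? T Z? r))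

    module _ {k} (T : Subset k) {Q : R → Set} (Q? : ∀ r → Dec (Q r)) {Z : Fin (suc k) → R → Set} (Z? : ∀ i r → Dec (Z i r)) where

      #allIn-true : #allIn (true ∷ T) Q? Z? ≡ #allIn T (λ r → Q? r ×-dec Z? zero r) (Z? ∘ suc)
      #allIn-true = sumR-cong λ r → 𝟙-cong (λ (q , z) → (q , z zero here) , λ i i∈T → z (suc i) (there i∈T))
                                            (λ ((q , z₀) , z′) → q , λ { zero _ → z₀ ; (suc i) (there i∈T) → z′ i i∈T }) _ _

      #allIn-false : #allIn (false ∷ T) Q? Z? ≡ #allIn T Q? (Z? ∘ suc)
      #allIn-false = sumR-cong λ r → 𝟙-cong (λ (q , z) → q , λ i i∈T → z (suc i) (there i∈T))
                                             (λ (q , z′) → q , λ { (suc i) (there i∈T) → z′ i i∈T }) _ _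

    sumR-split : ∀ {P Q S : R → Set} (P? : ∀ r → Dec (P r)) (Q? : ∀ r → Dec (Q r)) (S? : ∀ r → Dec (S r)) →
                 sumR (λ r → 𝟙 (P? r ×-dec S? r))
                   ≡ sumR (λ r → 𝟙 ((P? r ×-dec Q? r) ×-dec S? r)) ℕ.+ sumR (λ r → 𝟙 ((P? r ×-dec ¬? (Q? r)) ×-dec S? r))
    sumR-split P? Q? S? = trans (sumR-cong split) (sumR-+ _ _)
      where
      split : ∀ r → 𝟙 (P? r ×-dec S? r) ≡ 𝟙 ((P? r ×-dec Q? r) ×-dec S? r) ℕ.+ 𝟙 ((P? r ×-dec ¬? (Q? r)) ×-dec S? r)
      split r with P? r | Q? r | S? r
      ... | yes _ | yes _ | yes _ = refl
      ... | yes _ | no _  | yes _ = refl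
      ... | yes _ | yes _ | no _  = refl
      ... | yes _ | no _  | no _  = refl
      ... | no _  | _     | _     = refl

    inclusion-exclusion : ∀ k {Q : R → Set} (Q? : ∀ r → Dec (Q r)) {Z : Fin k → R → Set} (Z? : ∀ i r → Dec (Z i r)) →
      + sumR (λ r → 𝟙 (Q? r ×-dec all? (λ i → ¬? (Z? i r)))) ≡ ∑ℤ (subsets k) (λ T → sgn ∣ T ∣ * + #allIn T Q? Z?)
    inclusion-exclusion zero Q? Z? = begin
      + sumR (λ r → 𝟙 (Q? r ×-dec all? (λ i → ¬? (Z? i r))))
        ≡⟨ cong +_ (sumR-cong λ r → 𝟙-cong (λ (q , _) → q , λ ()) (λ (q , _) → q , λ ()) _ (Q? r ×-dec allIn? [] Z? r)) ⟩
      + #allIn [] Q? Z?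
        ≡⟨ sym (trans (ℤ.+-identityʳ _) (ℤ.*-identityˡ _)) ⟩
      ∑ℤ (subsets zero) (λ T → sgn ∣ T ∣ * + #allIn T Q? Z?) ∎
      where open ≡-Reasoning
    -- the subsets containing 0 contribute, with opposite sign, the inclusion–exclusion sum
    -- for the elements satisfying Z 0
    inclusion-exclusion (suc k) {Q} Q? {Z} Z? = sym (begin
      ∑ℤ (subsets (suc k)) (λ T → sgn ∣ T ∣ * + #allIn T Q? Z?)
        ≡⟨ ∑ℤ-subsets-suc k _ ⟩
      ∑ℤ (subsets k) (λ T → sgn (suc ∣ T ∣) * + #allIn (true ∷ T) Q? Z?) + ∑ℤ (subsets k) (λ T → sgn ∣ T ∣ * + #allIn (false ∷ T) Q? Z?)
        ≡⟨ cong₂ _+_ (trans (∑ℤ-cong (subsets k) λ T → trans (sgn-suc ∣ T ∣ _) (cong (λ c → - (sgn ∣ T ∣ * + c)) (#allIn-true T Q? Z?)))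
                            (∑ℤ-neg (subsets k) _))
                     (∑ℤ-cong (subsets k) λ T → cong (λ c → sgn ∣ T ∣ * + c) (#allIn-false T Q? Z?)) ⟩
      - ∑ℤ (subsets k) (λ T → sgn ∣ T ∣ * + #allIn T Q₀? (Z? ∘ suc)) + ∑ℤ (subsets k) (λ T → sgn ∣ T ∣ * + #allIn T Q? (Z? ∘ suc))
        ≡⟨ cong₂ (λ x y → - x + y) (sym (inclusion-exclusion k Q₀? (Z? ∘ suc))) (sym (inclusion-exclusion k Q? (Z? ∘ suc))) ⟩
      - + a + + sumR (λ r → 𝟙 (Q? r ×-dec none′? r))
        ≡⟨ cong (λ y → - + a + + y) (sumR-split Q? (Z? zero) none′?) ⟩
      - + a + (+ a + + b)
        ≡⟨ trans (sym (ℤ.+-assoc (- + a) (+ a) (+ b))) (trans (cong (_+ + b) (ℤ.+-inverseˡ (+ a))) (ℤ.+-identityˡ (+ b))) ⟩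
      + b
        ≡⟨ cong +_ (sumR-cong λ r → 𝟙-cong (λ ((q , ¬z₀) , ¬z′) → q , λ { zero → ¬z₀ ; (suc i) → ¬z′ i })
                                            (λ (q , ¬z) → (q , ¬z zero) , ¬z ∘ suc) _ _) ⟩
      + sumR (λ r → 𝟙 (Q? r ×-dec all? (λ i → ¬? (Z? i r)))) ∎)
      where
      open ≡-Reasoning
      Q₀? : ∀ r → Dec (Q r × Z zero r)
      Q₀? r = Q? r ×-dec Z? zero r
      none′? : ∀ r → Dec (∀ i → ¬ Z (suc i) r)
      none′? r = all? (λ i → ¬? (Z? (suc i) r))
      a b : ℕ
      a = sumR (λ r → 𝟙 (Q₀? r ×-dec none′? r))
      b = sumR (λ r → 𝟙 ((Q? r ×-dec ¬? (Z? zero r)) ×-dec none′? r))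

module FinGroup where

  open import Level using (0ℓ)
  open import Algebra.Bundles using (AbelianGroup; CommutativeMonoid)
  open import Algebra.Structures using (IsAbelianGroup)
  open import Data.Nat using (ℕ; zero; suc; _*_)
  open import Data.Fin using (Fin; zero; suc; _≟_; inject₁; fromℕ)
  open import Data.Fin.Permutation using (Permutation; permutation)
  open import Data.Vec using (Vec; []; _∷_; lookup; zipWith)
  open import Data.Vec.Properties using (lookup-zipWith)
  open import Relation.Nullary using (¬_; Dec; yes; no)
  open import Relation.Binary.PropositionalEquality using (_≡_; _≢_; refl; sym; trans; cong)
  open import Data.Empty using (⊥-elim)
  open Counting using (𝟙; 𝟙-cong; sum-syntax; ∑-cong; ∑-δ; ∑-permute; module MonoidSum; module SumsOver)

  record FinAbelianGroup (s : ℕ) : Set where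
    infixl 6 _⊕_
    infix  8 ⊖_
    field
      _⊕_            : Fin s → Fin s → Fin s
      𝟘              : Fin s
      ⊖_             : Fin s → Fin s
      isAbelianGroup : IsAbelianGroup _≡_ _⊕_ 𝟘 ⊖_

  module FinGroupSums {s : ℕ} (𝔾 : FinAbelianGroup s) where

    open FinAbelianGroup 𝔾 public
    open IsAbelianGroup isAbelianGroup public using (assoc; comm; identityˡ; identityʳ; inverseˡ; inverseʳ)

    abelianGroup : AbelianGroup 0ℓ 0ℓ
    abelianGroup = record { isAbelianGroup = isAbelianGroup }

    open AbelianGroup abelianGroup using (commutativeMonoid; group)
    open import Algebra.Properties.Group group public using (ε⁻¹≈ε; ⁻¹-involutive; ∙-cancelʳ; inverseˡ-unique)
    open import Algebra.Properties.AbelianGroup abelianGroup using (⁻¹-∙-comm)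
    open import Algebra.Properties.CommutativeSemigroup (CommutativeMonoid.commutativeSemigroup commutativeMonoid) public
      using (interchange)
    import Algebra.Properties.CommutativeMonoid.Sum commutativeMonoid as Sum

    ⊖-⊕ : ∀ a b → ⊖ (a ⊕ b) ≡ ⊖ a ⊕ ⊖ b
    ⊖-⊕ a b = sym (⁻¹-∙-comm a b)

    ∑ᴳ : ∀ n → (Fin n → Fin s) → Fin s
    ∑ᴳ n = Sum.sum {n}

    ∑ᴳ-cong : ∀ n {f g : Fin n → Fin s} → (∀ i → f i ≡ g i) → ∑ᴳ n f ≡ ∑ᴳ n g
    ∑ᴳ-cong n = Sum.sum-cong-≗ {n}

    ∑ᴳ-𝟘 : ∀ n → ∑ᴳ n (λ _ → 𝟘) ≡ 𝟘
    ∑ᴳ-𝟘 = Sum.sum-replicate-zero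

    ∑ᴳ-⊕ : ∀ n (f g : Fin n → Fin s) → ∑ᴳ n (λ i → f i ⊕ g i) ≡ ∑ᴳ n f ⊕ ∑ᴳ n g
    ∑ᴳ-⊕ n = Sum.∑-distrib-+ {n}

    ∑ᴳ-comm : ∀ m n (f : Fin m → Fin n → Fin s) → ∑ᴳ m (λ i → ∑ᴳ n (f i)) ≡ ∑ᴳ n (λ j → ∑ᴳ m (λ i → f i j))
    ∑ᴳ-comm m n = Sum.∑-comm {m} {n}

    ∑ᴳ-single : ∀ n (j : Fin n) (f : Fin n → Fin s) → (∀ i → i ≢ j → f i ≡ 𝟘) → ∑ᴳ n f ≡ f j
    ∑ᴳ-single n = MonoidSum.sum-single commutativeMonoid {n}

    ∑ᴳ-init-last : ∀ k (f : Fin (suc k) → Fin s) → ∑ᴳ (suc k) f ≡ ∑ᴳ k (λ i → f (inject₁ i)) ⊕ f (fromℕ k)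
    ∑ᴳ-init-last k = Sum.sum-init-last {k}

    ∑ᴳ-hom : (h : Fin s → Fin s) → h 𝟘 ≡ 𝟘 → (∀ a b → h (a ⊕ b) ≡ h a ⊕ h b) →
             ∀ n (f : Fin n → Fin s) → h (∑ᴳ n f) ≡ ∑ᴳ n (λ i → h (f i))
    ∑ᴳ-hom h h𝟘 h⊕ zero    f = h𝟘
    ∑ᴳ-hom h h𝟘 h⊕ (suc n) f = trans (h⊕ (f zero) _) (cong (h (f zero) ⊕_) (∑ᴳ-hom h h𝟘 h⊕ n (λ i → f (suc i))))

    ∑ᴳ-⊖ : ∀ n (f : Fin n → Fin s) → ∑ᴳ n (λ i → ⊖ f i) ≡ ⊖ ∑ᴳ n f
    ∑ᴳ-⊖ n f = sym (∑ᴳ-hom ⊖_ ε⁻¹≈ε ⊖-⊕ n f)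

    infix 9 [_]·_
    [_]·_ : ∀ {p} {P : Set p} → Dec P → Fin s → Fin s
    [ yes _ ]· g = g
    [ no _  ]· g = 𝟘

    ·-⊕ : ∀ {p} {P : Set p} (P? : Dec P) a b → [ P? ]· (a ⊕ b) ≡ [ P? ]· a ⊕ [ P? ]· b
    ·-⊕ (yes _) a b = refl
    ·-⊕ (no _)  a b = sym (identityˡ 𝟘)

    ·-𝟘 : ∀ {p} {P : Set p} (P? : Dec P) → [ P? ]· 𝟘 ≡ 𝟘
    ·-𝟘 (yes _) = refl
    ·-𝟘 (no _)  = refl

    ·-⊖ : ∀ {p} {P : Set p} (P? : Dec P) a → [ P? ]· (⊖ a) ≡ ⊖ [ P? ]· a
    ·-⊖ (yes _) a = refl
    ·-⊖ (no _)  a = sym ε⁻¹≈ε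

    ·-∑ᴳ : ∀ {p} {P : Set p} (P? : Dec P) n (f : Fin n → Fin s) → [ P? ]· ∑ᴳ n f ≡ ∑ᴳ n (λ i → [ P? ]· f i)
    ·-∑ᴳ P? = ∑ᴳ-hom [ P? ]·_ (·-𝟘 P?) (·-⊕ P?)

    ·-cong : ∀ {p q} {P : Set p} {Q : Set q} → (P → Q) → (Q → P) → (P? : Dec P) (Q? : Dec Q) (g : Fin s) → [ P? ]· g ≡ [ Q? ]· g
    ·-cong _ _ (yes _) (yes _) g = refl
    ·-cong f _ (yes p) (no ¬q) g = ⊥-elim (¬q (f p))
    ·-cong _ h (no ¬p) (yes q) g = ⊥-elim (¬p (h q))
    ·-cong _ _ (no _)  (no _)  g = refl

    ·-yes : ∀ {p} {P : Set p} (P? : Dec P) → P → ∀ g → [ P? ]· g ≡ g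
    ·-yes (yes _) _ g = refl
    ·-yes (no ¬p) p g = ⊥-elim (¬p p)

    ·-no : ∀ {p} {P : Set p} (P? : Dec P) → ¬ P → ∀ g → [ P? ]· g ≡ 𝟘
    ·-no (yes p) ¬p g = ⊥-elim (¬p p)
    ·-no (no _)  _  g = refl

    ∑ᴳ-δ : ∀ n (j : Fin n) (f : Fin n → Fin s) → ∑ᴳ n (λ i → [ i ≟ j ]· f i) ≡ f j
    ∑ᴳ-δ n j f = trans (∑ᴳ-single n j _ (λ i i≢j → ·-no (i ≟ j) i≢j (f i))) (·-yes (j ≟ j) refl (f j))

    open SumsOver s

    infixl 6 _+ᵥ_
    _+ᵥ_ : ∀ {N} → Vec (Fin s) N → Vec (Fin s) N → Vec (Fin s) N
    _+ᵥ_ = zipWith _⊕_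

    lookup-+ᵥ : ∀ {N} (v w : Vec (Fin s) N) e → lookup (v +ᵥ w) e ≡ lookup v e ⊕ lookup w e
    lookup-+ᵥ v w e = lookup-zipWith _⊕_ e v w

    translation : Fin s → Permutation s s
    translation c = permutation (_⊕ c) (_⊕ ⊖ c)
      (λ y → trans (assoc y (⊖ c) c) (trans (cong (y ⊕_) (inverseˡ c)) (identityʳ y)))
      (λ y → trans (assoc y c (⊖ c)) (trans (cong (y ⊕_) (inverseʳ c)) (identityʳ y)))

    ∑-translate : (c : Fin s) (f : Fin s → ℕ) → ∑[ x < s ] f (x ⊕ c) ≡ ∑[ x < s ] f x
    ∑-translate c f = sym (∑-permute f (translation c))

    ∑ᵛ-translate : ∀ N (w : Vec (Fin s) N) (f : Vec (Fin s) N → ℕ) → ∑ᵛ N (λ v → f (v +ᵥ w)) ≡ ∑ᵛ N f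
    ∑ᵛ-translate zero    []      f = refl
    ∑ᵛ-translate (suc N) (c ∷ w) f = trans (∑-cong {s} (λ x → ∑ᵛ-translate N w (λ v → f ((x ⊕ c) ∷ v))))
                                           (∑-translate c (λ x → ∑ᵛ N (λ v → f (x ∷ v))))

    ∑-δ-⊖ : (t : Fin s) (f : Fin s → ℕ) → ∑[ a < s ] (𝟙 (a ⊕ t ≟ 𝟘) * f a) ≡ f (⊖ t)
    ∑-δ-⊖ t f = trans (∑-cong {s} λ a → cong (_* f a) (𝟙-cong (inverseˡ-unique a t) (λ { refl → inverseˡ t }) (a ⊕ t ≟ 𝟘) (a ≟ ⊖ t)))
                      (∑-δ (⊖ t) f)

module GraphFlows where

  open import Data.Nat using (ℕ; zero; suc; _*_; _∸_; _^_; _≤_; _<_)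
  open import Data.Nat.Properties using (+-∸-assoc; m≤n⇒m∸n≡0; <-irrefl; ≤-trans; *-identityʳ; 0≢1+n; suc-injective)
  open import Data.Fin using (Fin; zero; suc; _≟_; fromℕ; inject₁; toℕ)
  open import Data.Fin.Properties using (all?; any?; inject₁-injective; toℕ-inject₁)
  import Data.Fin.Properties as Fin
  open import Data.Fin.Relation.Unary.Top using (view; ‵fromℕ; ‵inj₁)
  open import Data.Fin.Subset using (Subset; _∈_; _∉_; _⊆_; ∣_∣; _-_; _∪_; ⁅_⁆)
  open import Data.Fin.Subset.Properties
    using (_∈?_; p⊆q⇒∣p∣≤∣q∣; p⊂q⇒∣p∣<∣q∣; p⊆p∪q; x∈p∪q⁺; x∈p∪q⁻; x∈⁅x⁆; x∈⁅y⁆⇒x≡y; x≢y⇒x∉⁅y⁆;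
           x∈p∧x∉q⇒x∈p─q; p─q⊆p; p─⊥≡p)
  open import Data.Vec using (Vec; []; _∷_; lookup; replicate; tabulate; here; there)
  open import Data.Vec.Properties using (lookup∘tabulate; lookup-replicate; ≡-dec)
  open import Data.Maybe using (just; nothing; fromMaybe)
  import Data.Maybe as Maybe
  open import Data.Bool using (true; false)
  open import Data.Product using (Σ; _×_; _,_; proj₁; proj₂)
  open import Data.Sum using (_⊎_; inj₁; inj₂)
  open import Data.Empty using (⊥-elim)
  open import Function using (_∘_)
  open import Function.Definitions using (Injective)
  open import Relation.Nullary using (¬_; Dec; yes; no)
  open import Relation.Nullary.Decidable using (_×-dec_; ¬?; _→-dec_; decidable-stable)
  open import Relation.Nullary.Decidable.Core using (¬¬-excluded-middle)
  open import Relation.Binary.PropositionalEquality using (_≡_; _≢_; refl; sym; trans; cong; cong₂; subst; subst₂; module ≡-Reasoning)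
  open import Defs using (Cycle; Acyclic; IsCycleRank; Joins; next; inc)
  open Counting using (𝟙; 𝟙-cong; 𝟙-×; ∑-cong; ∑-const; sum-syntax; module SumsOver)
  open FinGroup using (FinAbelianGroup; module FinGroupSums)

  x∉p-x : ∀ {n} (x : Fin n) (p : Subset n) → x ∉ p - x
  x∉p-x zero    (b ∷ p) ()
  x∉p-x (suc x) (b ∷ p) (there x∈p-x) = x∉p-x x p x∈p-x

  x∈p∧x≢y⇒x∈p-y : ∀ {n} {x y : Fin n} {p : Subset n} → x ∈ p → x ≢ y → x ∈ p - y
  x∈p∧x≢y⇒x∈p-y x∈p x≢y = x∈p∧x∉q⇒x∈p─q x∈p (x≢y⇒x∉⁅y⁆ x≢y)

  p-x⊆p : ∀ {n} (p : Subset n) (x : Fin n) → p - x ⊆ p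
  p-x⊆p p x = p─q⊆p p ⁅ x ⁆

  ∣p∣≡1+∣p-x∣ : ∀ {n} {x : Fin n} {p : Subset n} → x ∈ p → ∣ p ∣ ≡ suc ∣ p - x ∣
  ∣p∣≡1+∣p-x∣ {p = true ∷ p} here = cong (suc ∘ ∣_∣) (sym (p─⊥≡p p))
  ∣p∣≡1+∣p-x∣ {x = suc x} {p = true  ∷ p} (there x∈p) = cong suc (∣p∣≡1+∣p-x∣ x∈p)
  ∣p∣≡1+∣p-x∣ {x = suc x} {p = false ∷ p} (there x∈p) = ∣p∣≡1+∣p-x∣ x∈p

  x∉p⇒∣p∣<∣p∪⁅x⁆∣ : ∀ {n} {x : Fin n} {p : Subset n} → x ∉ p → ∣ p ∣ < ∣ p ∪ ⁅ x ⁆ ∣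
  x∉p⇒∣p∣<∣p∪⁅x⁆∣ {x = x} x∉p = p⊂q⇒∣p∣<∣q∣ (p⊆p∪q ⁅ x ⁆ , x , x∈p∪q⁺ (inj₂ (x∈⁅x⁆ x)) , x∉p)

  x∈p∪⁅y⁆⁻ : ∀ {n} {x y : Fin n} (p : Subset n) → x ∈ p ∪ ⁅ y ⁆ → x ∈ p ⊎ x ≡ y
  x∈p∪⁅y⁆⁻ {y = y} p x∈p∪y with x∈p∪q⁻ p ⁅ y ⁆ x∈p∪y
  ... | inj₁ x∈p = inj₁ x∈p
  ... | inj₂ x∈y = inj₂ (x∈⁅y⁆⇒x≡y y x∈y)

  appendLast : ∀ {k} {B : Set} → (Fin k → B) → B → Fin (suc k) → B
  appendLast {zero}  f b _       = b
  appendLast {suc k} f b zero    = f zero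
  appendLast {suc k} f b (suc i) = appendLast (f ∘ suc) b i

  appendLast-inject₁ : ∀ {k} {B : Set} (f : Fin k → B) b j → appendLast f b (inject₁ j) ≡ f j
  appendLast-inject₁ {suc k} f b zero    = refl
  appendLast-inject₁ {suc k} f b (suc j) = appendLast-inject₁ (f ∘ suc) b j

  appendLast-fromℕ : ∀ {k} {B : Set} (f : Fin k → B) b → appendLast f b (fromℕ k) ≡ b
  appendLast-fromℕ {zero}  f b = refl
  appendLast-fromℕ {suc k} f b = appendLast-fromℕ (f ∘ suc) b

  next-inject₁ : ∀ {k} (j : Fin k) → next (inject₁ j) ≡ suc j
  next-inject₁ j = cong (fromMaybe zero) (inc-inject₁ j)
    where
    inc-inject₁ : ∀ {k} (j : Fin k) → inc (inject₁ j) ≡ just (suc j)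
    inc-inject₁ {suc zero}    zero    = refl
    inc-inject₁ {suc (suc k)} zero    = refl
    inc-inject₁ {suc (suc k)} (suc j) = cong (Maybe.map suc) (inc-inject₁ j)

  next-fromℕ : ∀ k → next (fromℕ k) ≡ zero
  next-fromℕ k = cong (fromMaybe zero) (inc-fromℕ k)
    where
    inc-fromℕ : ∀ k → inc (fromℕ k) ≡ nothing
    inc-fromℕ zero          = refl
    inc-fromℕ (suc zero)    = refl
    inc-fromℕ (suc (suc k)) = cong (Maybe.map suc) (inc-fromℕ (suc k))

  Joins-sym : ∀ {n} {ab : Fin n × Fin n} {u w} → Joins ab u w → Joins ab w u
  Joins-sym (inj₁ (a≡u , b≡w)) = inj₂ (a≡u , b≡w)
  Joins-sym (inj₂ (a≡w , b≡u)) = inj₁ (a≡w , b≡u)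

  Joins-unique : ∀ {n} {ab : Fin n × Fin n} {u w u′ w′} → Joins ab u w → Joins ab u′ w′ →
                 (u ≡ u′ × w ≡ w′) ⊎ (u ≡ w′ × w ≡ u′)
  Joins-unique (inj₁ (refl , refl)) (inj₁ (refl , refl)) = inj₁ (refl , refl)
  Joins-unique (inj₁ (refl , refl)) (inj₂ (refl , refl)) = inj₂ (refl , refl)
  Joins-unique (inj₂ (refl , refl)) (inj₁ (refl , refl)) = inj₂ (refl , refl)
  Joins-unique (inj₂ (refl , refl)) (inj₂ (refl , refl)) = inj₁ (refl , refl)

  ¬¬-decidable : ∀ n (P : Fin n → Set) → ¬ ¬ (∀ x → Dec (P x))
  ¬¬-decidable zero    P k = k (λ ())
  ¬¬-decidable (suc n) P k = ¬¬-excluded-middle λ P₀? → ¬¬-decidable n (P ∘ suc) λ P₊? → k λ { zero → P₀? ; (suc x) → P₊? x }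

  module Incidence {s : ℕ} (𝔾 : FinAbelianGroup s) (n : ℕ) where

    open FinGroupSums 𝔾

    -- [a = x] g − [b = x] g: the edge (a , b) carrying g flows into a and out of b
    incidence : Fin n × Fin n → Fin n → Fin s → Fin s
    incidence (a , b) x g = [ a ≟ x ]· g ⊕ ⊖ [ b ≟ x ]· g

    incidence-𝟘 : ∀ ab x → incidence ab x 𝟘 ≡ 𝟘
    incidence-𝟘 (a , b) x = begin
      [ a ≟ x ]· 𝟘 ⊕ ⊖ [ b ≟ x ]· 𝟘 ≡⟨ cong₂ (λ p q → p ⊕ ⊖ q) (·-𝟘 (a ≟ x)) (·-𝟘 (b ≟ x)) ⟩
      𝟘 ⊕ ⊖ 𝟘                      ≡⟨ trans (cong (𝟘 ⊕_) ε⁻¹≈ε) (identityˡ 𝟘) ⟩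
      𝟘                            ∎
      where open ≡-Reasoning

    incidence-⊕ : ∀ ab x g h → incidence ab x (g ⊕ h) ≡ incidence ab x g ⊕ incidence ab x h
    incidence-⊕ (a , b) x g h = begin
      [ a ≟ x ]· (g ⊕ h) ⊕ ⊖ [ b ≟ x ]· (g ⊕ h)
        ≡⟨ cong₂ (λ p q → p ⊕ ⊖ q) (·-⊕ (a ≟ x) g h) (·-⊕ (b ≟ x) g h) ⟩
      ([ a ≟ x ]· g ⊕ [ a ≟ x ]· h) ⊕ ⊖ ([ b ≟ x ]· g ⊕ [ b ≟ x ]· h)
        ≡⟨ cong (([ a ≟ x ]· g ⊕ [ a ≟ x ]· h) ⊕_) (⊖-⊕ _ _) ⟩
      ([ a ≟ x ]· g ⊕ [ a ≟ x ]· h) ⊕ (⊖ [ b ≟ x ]· g ⊕ ⊖ [ b ≟ x ]· h)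
        ≡⟨ interchange _ _ _ _ ⟩
      incidence (a , b) x g ⊕ incidence (a , b) x h ∎
      where open ≡-Reasoning

    incidence-· : ∀ {p} {P : Set p} (P? : Dec P) ab x g → incidence ab x ([ P? ]· g) ≡ [ P? ]· incidence ab x g
    incidence-· (yes _) ab x g = refl
    incidence-· (no _)  ab x g = incidence-𝟘 ab x

    incidence-∑ᴳ : ∀ k ab x (f : Fin k → Fin s) → incidence ab x (∑ᴳ k f) ≡ ∑ᴳ k (λ i → incidence ab x (f i))
    incidence-∑ᴳ k ab x = ∑ᴳ-hom (incidence ab x) (incidence-𝟘 ab x) (incidence-⊕ ab x) k

  module Flows {s : ℕ} (𝔾 : FinAbelianGroup s) {N n : ℕ} (ends : Fin N → Fin n × Fin n) where

    open FinGroupSums 𝔾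
    open SumsOver s
    open Incidence 𝔾 n public

    net : Vec (Fin s) N → Fin n → Fin s
    net v x = ∑ᴳ N (λ e → incidence (ends e) x (lookup v e))

    net-+ᵥ : ∀ v w x → net (v +ᵥ w) x ≡ net v x ⊕ net w x
    net-+ᵥ v w x = trans (∑ᴳ-cong N λ e → trans (cong (incidence (ends e) x) (lookup-+ᵥ v w e)) (incidence-⊕ (ends e) x _ _))
                         (∑ᴳ-⊕ N _ _)

    IsFlow : Vec (Fin s) N → Set
    IsFlow v = ∀ x → net v x ≡ 𝟘

    SupportedOn : Subset N → Vec (Fin s) N → Set
    SupportedOn A v = ∀ e → e ∉ A → lookup v e ≡ 𝟘

    FlowOn : Subset N → Vec (Fin s) N → Set
    FlowOn A v = SupportedOn A v × IsFlow v

    flowOn? : ∀ A v → Dec (FlowOn A v)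
    flowOn? A v = all? (λ e → ¬? (e ∈? A) →-dec (lookup v e ≟ 𝟘)) ×-dec all? (λ x → net v x ≟ 𝟘)

    #flows : Subset N → ℕ
    #flows A = ∑ᵛ N (λ v → 𝟙 (flowOn? A v))

    #flows-cong : ∀ {A B} → A ⊆ B → B ⊆ A → #flows A ≡ #flows B
    #flows-cong A⊆B B⊆A = ∑ᵛ-cong N λ v → 𝟙-cong (λ (supp , flow) → (λ e e∉B → supp e (e∉B ∘ A⊆B)) , flow)
                                                  (λ (supp , flow) → (λ e e∉A → supp e (e∉A ∘ B⊆A)) , flow) _ _

    ∑ᴳ-next : ∀ k (f : Fin (suc k) → Fin s) → ∑ᴳ (suc k) (λ i → f (next i)) ≡ ∑ᴳ (suc k) f
    ∑ᴳ-next k f = begin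
      ∑ᴳ (suc k) (λ i → f (next i))                   ≡⟨ ∑ᴳ-init-last k (λ i → f (next i)) ⟩
      ∑ᴳ k (λ j → f (next (inject₁ j))) ⊕ f (next (fromℕ k))
        ≡⟨ cong₂ _⊕_ (∑ᴳ-cong k (λ j → cong f (next-inject₁ j))) (cong f (next-fromℕ k)) ⟩
      ∑ᴳ k (λ j → f (suc j)) ⊕ f zero                 ≡⟨ comm _ _ ⟩
      ∑ᴳ (suc k) f                                    ∎
      where open ≡-Reasoning

    -- the value to put on an edge joining u and w so that it carries g from u to w
    orient : ∀ {ab : Fin n × Fin n} {u w} → Joins ab u w → Fin s → Fin s
    orient (inj₁ _) g = ⊖ g
    orient (inj₂ _) g = g

    orient-involutive : ∀ {ab : Fin n × Fin n} {u w} (j : Joins ab u w) g → orient j (orient j g) ≡ g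
    orient-involutive (inj₁ _) g = ⁻¹-involutive g
    orient-involutive (inj₂ _) g = refl

    incidence-orient : ∀ {ab u w} (j : Joins ab u w) x g → incidence ab x (orient j g) ≡ [ w ≟ x ]· g ⊕ ⊖ [ u ≟ x ]· g
    incidence-orient {a , b} (inj₁ (refl , refl)) x g = begin
      [ a ≟ x ]· (⊖ g) ⊕ ⊖ [ b ≟ x ]· (⊖ g) ≡⟨ cong₂ (λ p q → p ⊕ ⊖ q) (·-⊖ (a ≟ x) g) (·-⊖ (b ≟ x) g) ⟩
      ⊖ [ a ≟ x ]· g ⊕ ⊖ ⊖ [ b ≟ x ]· g     ≡⟨ cong (⊖ [ a ≟ x ]· g ⊕_) (⁻¹-involutive _) ⟩
      ⊖ [ a ≟ x ]· g ⊕ [ b ≟ x ]· g         ≡⟨ comm _ _ ⟩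
      [ b ≟ x ]· g ⊕ ⊖ [ a ≟ x ]· g         ∎
      where open ≡-Reasoning
    incidence-orient (inj₂ (refl , refl)) x g = refl

    module CycleFlow (c : Cycle ends) where
      open Cycle c

      circulation : Fin s → Vec (Fin s) N
      circulation g = tabulate (λ e → ∑ᴳ (suc len) (λ i → [ es i ≟ e ]· orient (joins i) g))

      lookup-circulation : ∀ g e → lookup (circulation g) e ≡ ∑ᴳ (suc len) (λ i → [ es i ≟ e ]· orient (joins i) g)
      lookup-circulation g e = lookup∘tabulate (λ e → ∑ᴳ (suc len) (λ i → [ es i ≟ e ]· orient (joins i) g)) e

      circulation-at : ∀ g i → lookup (circulation g) (es i) ≡ orient (joins i) g
      circulation-at g i = trans (lookup-circulation g (es i))
        (trans (∑ᴳ-single (suc len) i (λ i′ → [ es i′ ≟ es i ]· orient (joins i′) g)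
                                      (λ i′ i′≢i → ·-no (es i′ ≟ es i) (i′≢i ∘ es-inj) _))
               (·-yes (es i ≟ es i) refl _))

      circulation-outside : ∀ g e → (∀ i → es i ≢ e) → lookup (circulation g) e ≡ 𝟘
      circulation-outside g e e∉c = trans (lookup-circulation g e)
        (trans (∑ᴳ-cong (suc len) (λ i → ·-no (es i ≟ e) (e∉c i) (orient (joins i) g))) (∑ᴳ-𝟘 (suc len)))

      -- the cycle sum telescopes: each vertex vs i receives g from one cycle edge and passes it on
      circulation-isFlow : ∀ g → IsFlow (circulation g)
      circulation-isFlow g x = begin
        ∑ᴳ N (λ e → incidence (ends e) x (lookup (circulation g) e))
          ≡⟨ ∑ᴳ-cong N (λ e → trans (cong (incidence (ends e) x) (lookup-circulation g e))
                                    (trans (incidence-∑ᴳ (suc len) (ends e) x (λ i → [ es i ≟ e ]· flowOf i))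
                                           (∑ᴳ-cong (suc len) λ i → incidence-· (es i ≟ e) (ends e) x (flowOf i)))) ⟩
        ∑ᴳ N (λ e → ∑ᴳ (suc len) (λ i → [ es i ≟ e ]· incidence (ends e) x (flowOf i)))
          ≡⟨ ∑ᴳ-comm N (suc len) (λ e i → [ es i ≟ e ]· incidence (ends e) x (flowOf i)) ⟩
        ∑ᴳ (suc len) (λ i → ∑ᴳ N (λ e → [ es i ≟ e ]· incidence (ends e) x (flowOf i)))
          ≡⟨ ∑ᴳ-cong (suc len) (λ i → trans (∑ᴳ-cong N λ e → ·-cong sym sym (es i ≟ e) (e ≟ es i) (incidence (ends e) x (flowOf i)))
                                            (∑ᴳ-δ N (es i) (λ e → incidence (ends e) x (flowOf i)))) ⟩
        ∑ᴳ (suc len) (λ i → incidence (ends (es i)) x (flowOf i))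
          ≡⟨ ∑ᴳ-cong (suc len) (λ i → incidence-orient (joins i) x g) ⟩
        ∑ᴳ (suc len) (λ i → [ vs (next i) ≟ x ]· g ⊕ ⊖ [ vs i ≟ x ]· g)
          ≡⟨ ∑ᴳ-⊕ (suc len) (λ i → [ vs (next i) ≟ x ]· g) (λ i → ⊖ [ vs i ≟ x ]· g) ⟩
        ∑ᴳ (suc len) (λ i → [ vs (next i) ≟ x ]· g) ⊕ ∑ᴳ (suc len) (λ i → ⊖ [ vs i ≟ x ]· g)
          ≡⟨ cong₂ _⊕_ (∑ᴳ-next len (λ i → [ vs i ≟ x ]· g)) (∑ᴳ-⊖ (suc len) (λ i → [ vs i ≟ x ]· g)) ⟩
        ∑ᴳ (suc len) (λ i → [ vs i ≟ x ]· g) ⊕ ⊖ ∑ᴳ (suc len) (λ i → [ vs i ≟ x ]· g)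
          ≡⟨ inverseʳ _ ⟩
        𝟘 ∎
        where
        open ≡-Reasoning
        flowOf : Fin (suc len) → Fin s
        flowOf i = orient (joins i) g

      circulationThrough : Fin (suc len) → Fin s → Vec (Fin s) N
      circulationThrough i g = circulation (orient (joins i) g)

      circulationThrough-at : ∀ i g → lookup (circulationThrough i g) (es i) ≡ g
      circulationThrough-at i g = trans (circulation-at (orient (joins i) g) i) (orient-involutive (joins i) g)

    -- translation by a flow h on A with h e = g identifies the flows on A - e with the flows on A taking the value g at e
    module _ {A : Subset N} {e : Fin N} (h : Vec (Fin s) N) (h-flowOn : FlowOn A h) {g : Fin s} (he≡g : lookup h e ≡ g) where

      private
        net-shift : ∀ v x → net (v +ᵥ h) x ≡ net v x
        net-shift v x = trans (net-+ᵥ v h x) (trans (cong (net v x ⊕_) (proj₂ h-flowOn x)) (identityʳ _))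

        lookup-shift : ∀ v e′ → e′ ∉ A → lookup (v +ᵥ h) e′ ≡ lookup v e′
        lookup-shift v e′ e′∉A = trans (lookup-+ᵥ v h e′) (trans (cong (lookup v e′ ⊕_) (proj₁ h-flowOn e′ e′∉A)) (identityʳ _))

      flowOn-shift⁻ : ∀ v → g ≡ lookup (v +ᵥ h) e × FlowOn A (v +ᵥ h) → FlowOn (A - e) v
      flowOn-shift⁻ v (g≡ , supp , flow) = supported , λ x → trans (sym (net-shift v x)) (flow x)
        where
        ve≡𝟘 : lookup v e ≡ 𝟘
        ve≡𝟘 = ∙-cancelʳ g (lookup v e) 𝟘
                 (trans (sym (trans (lookup-+ᵥ v h e) (cong (lookup v e ⊕_) he≡g))) (trans (sym g≡) (sym (identityˡ g))))
        supported : SupportedOn (A - e) v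
        supported e′ e′∉A-e with e′ ≟ e
        ... | yes refl = ve≡𝟘
        ... | no e′≢e  = trans (sym (lookup-shift v e′ e′∉A)) (supp e′ e′∉A)
          where e′∉A : e′ ∉ A
                e′∉A e′∈A = e′∉A-e (x∈p∧x≢y⇒x∈p-y e′∈A e′≢e)

      flowOn-shift⁺ : ∀ v → FlowOn (A - e) v → g ≡ lookup (v +ᵥ h) e × FlowOn A (v +ᵥ h)
      flowOn-shift⁺ v (supp , flow) = g≡ , supported , λ x → trans (net-shift v x) (flow x)
        where
        g≡ : g ≡ lookup (v +ᵥ h) e
        g≡ = sym (trans (lookup-+ᵥ v h e) (trans (cong₂ _⊕_ (supp e (x∉p-x e A)) he≡g) (identityˡ g)))
        supported : SupportedOn A (v +ᵥ h)
        supported e′ e′∉A = trans (lookup-shift v e′ e′∉A) (supp e′ (e′∉A ∘ p-x⊆p A e))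

      #flows-fibre : ∑ᵛ N (λ v → 𝟙 (g ≟ lookup v e) * 𝟙 (flowOn? A v)) ≡ #flows (A - e)
      #flows-fibre = trans (sym (∑ᵛ-translate N h _)) (∑ᵛ-cong N λ v →
        trans (sym (𝟙-× (g ≟ lookup (v +ᵥ h) e) (flowOn? A (v +ᵥ h)))) (𝟙-cong (flowOn-shift⁻ v) (flowOn-shift⁺ v) _ _))

    #flows-removeCycleEdge : ∀ A (c : Cycle ends) → (∀ i → Cycle.es c i ∈ A) → ∀ i →
                             #flows A ≡ s * #flows (A - Cycle.es c i)
    #flows-removeCycleEdge A c c⊆A i = begin
      #flows A                                                        ≡⟨ ∑ᵛ-splitAt N e _ ⟩
      ∑[ g < s ] ∑ᵛ N (λ v → 𝟙 (g ≟ lookup v e) * 𝟙 (flowOn? A v))    ≡⟨ ∑-cong {s} fibre ⟩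
      ∑[ g < s ] #flows (A - e)                                       ≡⟨ ∑-const s _ ⟩
      s * #flows (A - e)                                              ∎
      where
      open ≡-Reasoning
      open CycleFlow c
      e = Cycle.es c i
      fibre : ∀ g → ∑ᵛ N (λ v → 𝟙 (g ≟ lookup v e) * 𝟙 (flowOn? A v)) ≡ #flows (A - e)
      fibre g = #flows-fibre (circulationThrough i g)
        ((λ e′ e′∉A → circulation-outside _ e′ λ i′ es≡e′ → e′∉A (subst (_∈ A) es≡e′ (c⊆A i′))) , circulation-isFlow _)
        (circulationThrough-at i g)

    module Reachability (F : Subset N) (e₀ : Fin N) where

      source : Fin n
      source = proj₁ (ends e₀)

      data Walk : ℕ → Fin n → Set where
        stay : Walk zero source
        step : ∀ {k x} → Walk k x → (f : Fin N) → f ∈ F → f ≢ e₀ → (y : Fin n) → Joins (ends f) x y → Walk (suc k) y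

      -- the vertices of the walk, latest first
      vertices : ∀ {k x} → Walk k x → Vec (Fin n) (suc k)
      vertices stay                 = source ∷ []
      vertices (step w _ _ _ y _)   = y ∷ vertices w

      edges : ∀ {k x} → Walk k x → Vec (Fin N) k
      edges stay                 = []
      edges (step w f _ _ _ _)   = f ∷ edges w

      Simple : ∀ {k x} → Walk k x → Set
      Simple w = Injective _≡_ _≡_ (lookup (vertices w))

      Reachable : Fin n → Set
      Reachable x = Σ ℕ λ k → Σ (Walk k x) Simple

      vertices-first : ∀ {k x} (w : Walk k x) → lookup (vertices w) zero ≡ x
      vertices-first stay               = refl
      vertices-first (step w _ _ _ _ _) = refl

      vertices-last : ∀ {k x} (w : Walk k x) → lookup (vertices w) (fromℕ k) ≡ source
      vertices-last stay               = refl
      vertices-last (step w _ _ _ _ _) = vertices-last w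

      edges-∈F : ∀ {k x} (w : Walk k x) j → lookup (edges w) j ∈ F
      edges-∈F (step w f f∈F _ _ _) zero    = f∈F
      edges-∈F (step w _ _ _ _ _)   (suc j) = edges-∈F w j

      edges-≢e₀ : ∀ {k x} (w : Walk k x) j → lookup (edges w) j ≢ e₀
      edges-≢e₀ (step w f _ f≢e₀ _ _) zero    = f≢e₀
      edges-≢e₀ (step w _ _ _ _ _)    (suc j) = edges-≢e₀ w j

      edges-join : ∀ {k x} (w : Walk k x) (j : Fin k) →
                   Joins (ends (lookup (edges w) j)) (lookup (vertices w) (inject₁ j)) (lookup (vertices w) (suc j))
      edges-join (step w f _ _ y J) zero    = subst (Joins (ends f) y) (sym (vertices-first w)) (Joins-sym J)
      edges-join (step w _ _ _ _ _) (suc j) = edges-join w j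

      prefix-reachable : ∀ {k x} (w : Walk k x) → Simple w → (j : Fin (suc k)) → Reachable (lookup (vertices w) j)
      prefix-reachable {k} w simple zero = k , subst (λ z → Σ (Walk k z) Simple) (sym (vertices-first w)) (w , simple)
      prefix-reachable (step w _ _ _ _ _) simple (suc j) = prefix-reachable w (λ eq → Fin.suc-injective (simple eq)) j

      reachable-step : ∀ {x y} → Reachable x → (f : Fin N) → f ∈ F → f ≢ e₀ → Joins (ends f) x y → Reachable y
      reachable-step {y = y} (k , w , simple) f f∈F f≢e₀ J with any? (λ j → lookup (vertices w) j ≟ y)
      ... | yes (j , wj≡y) = subst Reachable wj≡y (prefix-reachable w simple j)
      ... | no y∉w = suc k , step w f f∈F f≢e₀ y J , simple′
        where
        simple′ : Simple (step w f f∈F f≢e₀ _ J)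
        simple′ {zero}  {zero}  _  = refl
        simple′ {zero}  {suc j} eq = ⊥-elim (y∉w (j , sym eq))
        simple′ {suc i} {zero}  eq = ⊥-elim (y∉w (i , eq))
        simple′ {suc i} {suc j} eq = cong suc (simple eq)

      edges-injective : ∀ {k x} (w : Walk k x) → Simple w → Injective _≡_ _≡_ (lookup (edges w))
      edges-injective w simple {j} {j′} eq
        with Joins-unique (edges-join w j) (subst (λ f → Joins (ends f) _ _) (sym eq) (edges-join w j′))
      ... | inj₁ (same , _)     = inject₁-injective (simple same)
      ... | inj₂ (cross₁ , cross₂) = ⊥-elim (<-asym j′<j j<j′)
        where
        open import Data.Nat.Properties using (<-asym; ≤-reflexive)
        j′<j : toℕ j′ < toℕ j
        j′<j = ≤-reflexive (trans (cong toℕ (sym (simple cross₁))) (toℕ-inject₁ j))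
        j<j′ : toℕ j < toℕ j′
        j<j′ = ≤-reflexive (trans (cong toℕ (simple cross₂)) (toℕ-inject₁ j′))

      closeWalk : ∀ {k} (w : Walk k (proj₂ (ends e₀))) → Simple w → Cycle ends
      closeWalk {k} w simple = record
        { len = k ; es = es ; vs = lookup (vertices w) ; es-inj = es-inj ; vs-inj = simple ; joins = joins }
        where
        es : Fin (suc k) → Fin N
        es = appendLast (lookup (edges w)) e₀
        es-inject₁ : ∀ j → es (inject₁ j) ≡ lookup (edges w) j
        es-inject₁ = appendLast-inject₁ (lookup (edges w)) e₀
        es-fromℕ : es (fromℕ k) ≡ e₀
        es-fromℕ = appendLast-fromℕ (lookup (edges w)) e₀
        es-inj : Injective _≡_ _≡_ es
        es-inj {i} {i′} eq with view i | view i′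
        ... | ‵fromℕ          | ‵fromℕ           = refl
        ... | ‵fromℕ          | ‵inj₁ {i = j} _  = ⊥-elim (edges-≢e₀ w j (trans (sym (es-inject₁ j)) (trans (sym eq) es-fromℕ)))
        ... | ‵inj₁ {i = j} _ | ‵fromℕ           = ⊥-elim (edges-≢e₀ w j (trans (sym (es-inject₁ j)) (trans eq es-fromℕ)))
        ... | ‵inj₁ {i = j} _ | ‵inj₁ {i = j′} _ = cong inject₁ (edges-injective w simple (trans (sym (es-inject₁ j)) (trans eq (es-inject₁ j′))))
        joins : ∀ i → Joins (ends (es i)) (lookup (vertices w) i) (lookup (vertices w) (next i))
        joins i with view i
        ... | ‵fromℕ = subst₂ (λ f z → Joins (ends f) (lookup (vertices w) (fromℕ k)) (lookup (vertices w) z))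
                              (sym es-fromℕ) (sym (next-fromℕ k))
                              (subst₂ (Joins (ends e₀)) (sym (vertices-last w)) (sym (vertices-first w)) (inj₁ (refl , refl)))
        ... | ‵inj₁ {i = j} _ = subst₂ (λ f z → Joins (ends f) (lookup (vertices w) (inject₁ j)) (lookup (vertices w) z))
                                     (sym (es-inject₁ j)) (sym (next-inject₁ j)) (edges-join w j)

      closeWalk-⊆F : ∀ {k} (w : Walk k (proj₂ (ends e₀))) (simple : Simple w) → e₀ ∈ F → ∀ i → Cycle.es (closeWalk w simple) i ∈ F
      closeWalk-⊆F {k} w simple e₀∈F i with view i
      ... | ‵fromℕ         = subst (_∈ F) (sym (appendLast-fromℕ (lookup (edges w)) e₀)) e₀∈F
      ... | ‵inj₁ {i = j} _ = subst (_∈ F) (sym (appendLast-inject₁ (lookup (edges w)) e₀ j)) (edges-∈F w j)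

    ∑ᴳ-·-δ : ∀ {p} {P : Fin n → Set p} (U : ∀ x → Dec (P x)) u g → ∑ᴳ n (λ x → [ U x ]· [ u ≟ x ]· g) ≡ [ U u ]· g
    ∑ᴳ-·-δ U u g = trans (∑ᴳ-single n u (λ x → [ U x ]· [ u ≟ x ]· g)
                           (λ x x≢u → trans (cong [ U x ]·_ (·-no (u ≟ x) (x≢u ∘ sym) g)) (·-𝟘 (U x))))
                         (cong [ U u ]·_ (·-yes (u ≟ u) refl g))

    -- Summing the flow condition over the vertices reachable from the tail of e₀ without using e₀
    -- leaves only the value on e₀, since its head is unreachable in a forest. Reachability is only
    -- decidable under a double negation, which suffices as the conclusion is decidable.
    acyclic-flow-vanishes : ∀ {F v} → Acyclic ends F → FlowOn F v → ∀ {e₀} → e₀ ∈ F → lookup v e₀ ≡ 𝟘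
    acyclic-flow-vanishes {F} {v} acyclic (supp , flow) {e₀} e₀∈F =
      decidable-stable (lookup v e₀ ≟ 𝟘) λ v₀≢𝟘 → ¬¬-decidable n Reachable λ U → v₀≢𝟘 (vanishes U)
      where
      open Reachability F e₀
      target = proj₂ (ends e₀)

      target-unreachable : ¬ Reachable target
      target-unreachable (k , w , simple) = acyclic (closeWalk w simple) (closeWalk-⊆F w simple e₀∈F)

      module _ (U : ∀ x → Dec (Reachable x)) where
        cut : Fin N → Fin s
        cut e = [ U (proj₁ (ends e)) ]· lookup v e ⊕ ⊖ [ U (proj₂ (ends e)) ]· lookup v e

        cut-other : ∀ e → e ≢ e₀ → cut e ≡ 𝟘
        cut-other e e≢e₀ with e ∈? F
        ... | no e∉F = trans (cong₂ (λ p q → [ U _ ]· p ⊕ ⊖ [ U _ ]· q) (supp e e∉F) (supp e e∉F))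
                             (trans (cong₂ (λ p q → p ⊕ ⊖ q) (·-𝟘 (U _)) (·-𝟘 (U _))) (trans (cong (𝟘 ⊕_) ε⁻¹≈ε) (identityˡ 𝟘)))
        ... | yes e∈F = trans (cong (_⊕ ⊖ [ U _ ]· lookup v e)
                                    (·-cong (λ r → reachable-step r e e∈F e≢e₀ (inj₁ (refl , refl)))
                                            (λ r → reachable-step r e e∈F e≢e₀ (inj₂ (refl , refl))) (U _) (U _) (lookup v e)))
                              (inverseʳ _)

        cut-e₀ : cut e₀ ≡ lookup v e₀
        cut-e₀ = trans (cong₂ (λ p q → p ⊕ ⊖ q) (·-yes (U source) (zero , stay , λ { {zero} {zero} _ → refl }) _)
                                                (·-no (U target) target-unreachable _))
                       (trans (cong (lookup v e₀ ⊕_) ε⁻¹≈ε) (identityʳ _))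

        net-over-U : ∑ᴳ n (λ x → [ U x ]· net v x) ≡ ∑ᴳ N cut
        net-over-U = begin
          ∑ᴳ n (λ x → [ U x ]· net v x)
            ≡⟨ ∑ᴳ-cong n (λ x → ·-∑ᴳ (U x) N _) ⟩
          ∑ᴳ n (λ x → ∑ᴳ N (λ e → [ U x ]· incidence (ends e) x (lookup v e)))
            ≡⟨ ∑ᴳ-comm n N _ ⟩
          ∑ᴳ N (λ e → ∑ᴳ n (λ x → [ U x ]· incidence (ends e) x (lookup v e)))
            ≡⟨ ∑ᴳ-cong N cut-as-sum ⟩
          ∑ᴳ N cut ∎
          where
          open ≡-Reasoning
          cut-as-sum : ∀ e → ∑ᴳ n (λ x → [ U x ]· incidence (ends e) x (lookup v e)) ≡ cut e
          cut-as-sum e = let (a , b) = ends e ; g = lookup v e in begin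
            ∑ᴳ n (λ x → [ U x ]· ([ a ≟ x ]· g ⊕ ⊖ [ b ≟ x ]· g))
              ≡⟨ ∑ᴳ-cong n (λ x → trans (·-⊕ (U x) _ _) (cong ([ U x ]· [ a ≟ x ]· g ⊕_) (·-⊖ (U x) _))) ⟩
            ∑ᴳ n (λ x → [ U x ]· [ a ≟ x ]· g ⊕ ⊖ [ U x ]· [ b ≟ x ]· g)
              ≡⟨ ∑ᴳ-⊕ n _ _ ⟩
            ∑ᴳ n (λ x → [ U x ]· [ a ≟ x ]· g) ⊕ ∑ᴳ n (λ x → ⊖ [ U x ]· [ b ≟ x ]· g)
              ≡⟨ cong₂ _⊕_ (∑ᴳ-·-δ U a g) (trans (∑ᴳ-⊖ n _) (cong ⊖_ (∑ᴳ-·-δ U b g))) ⟩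
            cut e ∎

        vanishes : lookup v e₀ ≡ 𝟘
        vanishes = begin
          lookup v e₀                    ≡⟨ sym cut-e₀ ⟩
          cut e₀                         ≡⟨ sym (∑ᴳ-single N e₀ cut cut-other) ⟩
          ∑ᴳ N cut                       ≡⟨ sym net-over-U ⟩
          ∑ᴳ n (λ x → [ U x ]· net v x)  ≡⟨ ∑ᴳ-cong n (λ x → trans (cong [ U x ]·_ (flow x)) (·-𝟘 (U x))) ⟩
          ∑ᴳ n (λ _ → 𝟘)                 ≡⟨ ∑ᴳ-𝟘 n ⟩
          𝟘                              ∎
          where open ≡-Reasoning

    #flows-acyclic : ∀ F → Acyclic ends F → #flows F ≡ 1
    #flows-acyclic F acyclic = trans (∑ᵛ-cong N λ v → trans (𝟙-cong (zero-flow v) (λ { refl → zeroFlowOn }) _ (≡-dec _≟_ v 𝟘ᵛ))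
                                                                (sym (*-identityʳ _)))
                                     (∑ᵛ-δ N 𝟘ᵛ (λ _ → 1))
      where
      𝟘ᵛ : Vec (Fin s) N
      𝟘ᵛ = replicate N 𝟘
      zeroFlowOn : FlowOn F 𝟘ᵛ
      zeroFlowOn = (λ e _ → lookup-replicate e 𝟘)
                 , λ x → trans (∑ᴳ-cong N λ e → trans (cong (incidence (ends e) x) (lookup-replicate e 𝟘)) (incidence-𝟘 (ends e) x)) (∑ᴳ-𝟘 N)
      zero-flow : ∀ v → FlowOn F v → v ≡ 𝟘ᵛ
      zero-flow v flowOn = vec-ext v λ e → vanishes-at e (e ∈? F)
        where
        vanishes-at : ∀ e → Dec (e ∈ F) → lookup v e ≡ 𝟘
        vanishes-at e (yes e∈F) = acyclic-flow-vanishes {v = v} acyclic flowOn e∈F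
        vanishes-at e (no e∉F)  = proj₁ flowOn e e∉F
        vec-ext : ∀ {k} (w : Vec (Fin s) k) → (∀ e → lookup w e ≡ 𝟘) → w ≡ replicate k 𝟘
        vec-ext []      _   = refl
        vec-ext (x ∷ w) w≡𝟘 = cong₂ _∷_ (w≡𝟘 zero) (vec-ext w (w≡𝟘 ∘ suc))

    -- Some cycle of F ∪ {e} passes through e; it is only obtained under a double negation,
    -- which is harmless as the equation is decidable.
    #flows-closingEdge : ∀ {A F e} → e ∈ A → F ⊆ A → Acyclic ends F → ¬ Acyclic ends (F ∪ ⁅ e ⁆) → #flows A ≡ s * #flows (A - e)
    #flows-closingEdge {A} {F} {e} e∈A F⊆A acyclic cyclic =
      decidable-stable (#flows A Data.Nat.≟ s * #flows (A - e)) λ ≢ → cyclic λ c c⊆F∪e → ≢ (throughCycle c c⊆F∪e)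
      where
      throughCycle : (c : Cycle ends) → (∀ i → Cycle.es c i ∈ F ∪ ⁅ e ⁆) → #flows A ≡ s * #flows (A - e)
      throughCycle c c⊆F∪e with any? (λ i → Cycle.es c i ≟ e)
      ... | yes (i , refl) = #flows-removeCycleEdge A c c⊆A i
        where
        c⊆A : ∀ i → Cycle.es c i ∈ A
        c⊆A i′ with x∈p∪⁅y⁆⁻ F (c⊆F∪e i′)
        ... | inj₁ f∈F = F⊆A f∈F
        ... | inj₂ f≡e = subst (_∈ A) (sym f≡e) e∈A
      ... | no e∉c = ⊥-elim (acyclic c c⊆F)
        where
        c⊆F : ∀ i → Cycle.es c i ∈ F
        c⊆F i with x∈p∪⁅y⁆⁻ F (c⊆F∪e i)
        ... | inj₁ f∈F = f∈F
        ... | inj₂ f≡e = ⊥-elim (e∉c (i , f≡e))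

    Maximal : Subset N → Subset N → Set
    Maximal A F = ∀ e → e ∈ A → e ∉ F → ¬ Acyclic ends (F ∪ ⁅ e ⁆)

    #flows-maximal : ∀ k A F → ∣ A ∣ ≡ k → F ⊆ A → Acyclic ends F → Maximal A F → #flows A ≡ s ^ (∣ A ∣ ∸ ∣ F ∣)
    #flows-maximal k A F ∣A∣≡k F⊆A acyclic maximal with any? (λ e → e ∈? A ×-dec ¬? (e ∈? F))
    ... | no A⊈F = begin
      #flows A            ≡⟨ #flows-cong A⊆F F⊆A ⟩
      #flows F            ≡⟨ #flows-acyclic F acyclic ⟩
      1                   ≡⟨ cong (s ^_) (sym (m≤n⇒m∸n≡0 (p⊆q⇒∣p∣≤∣q∣ A⊆F))) ⟩
      s ^ (∣ A ∣ ∸ ∣ F ∣) ∎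
      where
      open ≡-Reasoning
      A⊆F : A ⊆ F
      A⊆F {e} e∈A with e ∈? F
      ... | yes e∈F = e∈F
      ... | no e∉F  = ⊥-elim (A⊈F (e , e∈A , e∉F))
    ... | yes (e , e∈A , e∉F) = begin
      #flows A                     ≡⟨ #flows-closingEdge e∈A F⊆A acyclic (maximal e e∈A e∉F) ⟩
      s * #flows (A - e)           ≡⟨ cong (s *_) (recurse k ∣A∣≡k) ⟩
      s * s ^ (∣ A - e ∣ ∸ ∣ F ∣)
        ≡⟨ cong (s ^_) (sym (trans (cong (_∸ ∣ F ∣) ∣A∣≡1+∣A-e∣) (+-∸-assoc 1 (p⊆q⇒∣p∣≤∣q∣ F⊆A-e)))) ⟩
      s ^ (∣ A ∣ ∸ ∣ F ∣)          ∎
      where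
      open ≡-Reasoning
      ∣A∣≡1+∣A-e∣ = ∣p∣≡1+∣p-x∣ e∈A
      F⊆A-e : F ⊆ A - e
      F⊆A-e f∈F = x∈p∧x≢y⇒x∈p-y (F⊆A f∈F) λ { refl → e∉F f∈F }
      recurse : ∀ k → ∣ A ∣ ≡ k → #flows (A - e) ≡ s ^ (∣ A - e ∣ ∸ ∣ F ∣)
      recurse zero     ∣A∣≡0    = ⊥-elim (0≢1+n (trans (sym ∣A∣≡0) ∣A∣≡1+∣A-e∣))
      recurse (suc k′) ∣A∣≡1+k′ = #flows-maximal k′ (A - e) F (suc-injective (trans (sym ∣A∣≡1+∣A-e∣) ∣A∣≡1+k′)) F⊆A-e acyclic
                                    (λ e′ e′∈A-e → maximal e′ (p-x⊆p A e e′∈A-e))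

    #flows-rank : ∀ A ρ → IsCycleRank ends A ρ → #flows A ≡ s ^ (∣ A ∣ ∸ ρ)
    #flows-rank A ρ ((F , F⊆A , acyclic , ∣F∣≡ρ) , maximum) =
      trans (#flows-maximal _ A F refl F⊆A acyclic maximal) (cong (λ r → s ^ (∣ A ∣ ∸ r)) ∣F∣≡ρ)
      where
      maximal : Maximal A F
      maximal e e∈A e∉F acyclic′ =
        <-irrefl refl (≤-trans (x∉p⇒∣p∣<∣p∪⁅x⁆∣ e∉F) (subst (∣ F ∪ ⁅ e ⁆ ∣ ≤_) (sym ∣F∣≡ρ) (maximum _ F∪e⊆A acyclic′)))
        where
        F∪e⊆A : F ∪ ⁅ e ⁆ ⊆ A
        F∪e⊆A f∈F∪e with x∈p∪⁅y⁆⁻ F f∈F∪e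
        ... | inj₁ f∈F  = F⊆A f∈F
        ... | inj₂ refl = e∈A

module Hypergraph where

  open import Data.Nat using (ℕ; zero; suc; _*_)
  open import Data.Fin using (Fin; zero; suc; _≟_; toℕ)
  open import Data.Fin.Properties using (all?)
  open import Data.List using (List; []; _∷_; _++_; map; removeAt; lookup; length)
  open import Data.Vec using (Vec; []; _∷_)
  import Data.Vec as Vec
  open import Data.List.Properties using (∷-injectiveˡ; ∷-injectiveʳ)
  open import Data.List.Relation.Unary.All using (All; []; _∷_)
  import Data.List.Relation.Unary.All as All
  open import Data.List.Relation.Unary.All.Properties using (++⁺; ++⁻ˡ; ++⁻ʳ)
  open import Data.Product using (_×_; _,_; proj₁; proj₂)
  open import Data.Empty using (⊥-elim)
  open import Function using (_∘_; _⇔_; mk⇔; Equivalence)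
  open import Relation.Nullary using (¬_; Dec; yes; no)
  open import Relation.Nullary.Decidable using (_×-dec_; ¬?; _→-dec_)
  open import Relation.Binary.PropositionalEquality using (_≡_; refl; sym; trans; cong; cong₂; subst; module ≡-Reasoning)
  open import Defs using (Hyp; Choice; sgEdgesOf; sgEdges; bgEdges)
  open Counting
  open FinGroup using (FinAbelianGroup; module FinGroupSums)
  open GraphFlows using (module Incidence)

  module Transfer {s : ℕ} (𝔾 : FinAbelianGroup s) {n m : ℕ} (hs : Hyp n m) (ch : Choice hs) where

    open FinGroupSums 𝔾
    open SumsOver s
    open Incidence 𝔾 n using (incidence)

    listSum : ∀ {B : Set} → List B → (B → Fin s) → Fin s
    listSum []      h = 𝟘
    listSum (b ∷ r) h = h b ⊕ listSum r h

    module _ {B : Set} where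

      listSum-++ : ∀ (r₁ r₂ : List B) h → listSum (r₁ ++ r₂) h ≡ listSum r₁ h ⊕ listSum r₂ h
      listSum-++ []       r₂ h = sym (identityˡ _)
      listSum-++ (b ∷ r₁) r₂ h = trans (cong (h b ⊕_) (listSum-++ r₁ r₂ h)) (sym (assoc _ _ _))

      listSum-concatBlocks : ∀ k (rs : Fin k → List B) h → listSum (concatBlocks k rs) h ≡ ∑ᴳ k (λ j → listSum (rs j) h)
      listSum-concatBlocks zero    rs h = refl
      listSum-concatBlocks (suc k) rs h = trans (listSum-++ (rs zero) _ h) (cong (listSum (rs zero) h ⊕_) (listSum-concatBlocks k (rs ∘ suc) h))

      listSum-congᴬ : ∀ {P : B → Set} {r : List B} {h h′ : B → Fin s} → All P r → (∀ b → P b → h b ≡ h′ b) → listSum r h ≡ listSum r h′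
      listSum-congᴬ []       h≡h′ = refl
      listSum-congᴬ (p ∷ ps) h≡h′ = cong₂ _⊕_ (h≡h′ _ p) (listSum-congᴬ ps h≡h′)

      listSum-hom : (f : Fin s → Fin s) → f 𝟘 ≡ 𝟘 → (∀ a b → f (a ⊕ b) ≡ f a ⊕ f b) →
                    ∀ (r : List B) h → f (listSum r h) ≡ listSum r (f ∘ h)
      listSum-hom f f𝟘 f⊕ []      h = f𝟘
      listSum-hom f f𝟘 f⊕ (b ∷ r) h = trans (f⊕ _ _) (cong (f (h b) ⊕_) (listSum-hom f f𝟘 f⊕ r h))

      listSum-⊕ : ∀ (r : List B) h h′ → listSum r (λ b → h b ⊕ h′ b) ≡ listSum r h ⊕ listSum r h′
      listSum-⊕ []      h h′ = sym (identityˡ 𝟘)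
      listSum-⊕ (b ∷ r) h h′ = trans (cong (h b ⊕ h′ b ⊕_) (listSum-⊕ r h h′)) (interchange _ _ _ _)

      listSum-insertAt′ : ∀ k (b : B) (r : List B) h → listSum (insertAt′ k b r) h ≡ h b ⊕ listSum r h
      listSum-insertAt′ zero    b r       h = refl
      listSum-insertAt′ (suc k) b []      h = refl
      listSum-insertAt′ (suc k) b (y ∷ r) h = trans (cong (h y ⊕_) (listSum-insertAt′ k b r h))
        (trans (sym (assoc _ _ _)) (trans (cong (_⊕ listSum r h) (comm _ _)) (assoc _ _ _)))

    listSum-relabel : ∀ {X Y : Set} (f : X → Y) (r : List (X × Fin s)) h → listSum (relabel f r) h ≡ listSum r (λ (x , a) → h (f x , a))
    listSum-relabel f []      h = refl
    listSum-relabel f (p ∷ r) h = cong (_ ⊕_) (listSum-relabel f r h)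

    total : ∀ {X : Set} → List (X × Fin s) → Fin s
    total r = listSum r proj₂

    Zeros : ∀ {X : Set} → List (X × Fin s) → Set
    Zeros = All (λ (_ , a) → a ≡ 𝟘)

    total-Zeros : ∀ {X : Set} (r : List (X × Fin s)) → Zeros r → total r ≡ 𝟘
    total-Zeros []      []             = refl
    total-Zeros (p ∷ r) (a≡𝟘 ∷ zeros) = trans (cong₂ _⊕_ a≡𝟘 (total-Zeros r zeros)) (identityˡ 𝟘)

    Zeros-relabel : ∀ {X Y : Set} (f : X → Y) (r : List (X × Fin s)) → Zeros (relabel f r) ⇔ Zeros r
    Zeros-relabel f r = mk⇔ All.map⁻ All.map⁺
      where import Data.List.Relation.Unary.All.Properties as All

    Zeros-insertAt′ : ∀ {X : Set} k (b : X × Fin s) r → Zeros (insertAt′ k b r) ⇔ (proj₂ b ≡ 𝟘 × Zeros r)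
    Zeros-insertAt′ zero    b r       = mk⇔ (λ { (z ∷ zs) → z , zs }) (λ (z , zs) → z ∷ zs)
    Zeros-insertAt′ (suc k) b []      = mk⇔ (λ { (z ∷ zs) → z , [] }) (λ (z , zs) → z ∷ [])
    Zeros-insertAt′ (suc k) b (y ∷ r) = mk⇔
      (λ { (z ∷ zs) → let (b≡𝟘 , zs′) = Equivalence.to (Zeros-insertAt′ k b r) zs in b≡𝟘 , z ∷ zs′ })
      (λ { (b≡𝟘 , z ∷ zs) → z ∷ Equivalence.from (Zeros-insertAt′ k b r) (b≡𝟘 , zs) })

    module _ {Y : Set} where

      ZeroOn : Fin m → List ((Fin m × Y) × Fin s) → Set
      ZeroOn i = All (λ ((j , _) , a) → j ≡ i → a ≡ 𝟘)

      zeroOn? : ∀ i r → Dec (ZeroOn i r)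
      zeroOn? i = All.all? (λ ((j , _) , a) → (j ≟ i) →-dec (a ≟ 𝟘))

      LabelledBy : Fin m → List ((Fin m × Y) × Fin s) → Set
      LabelledBy j = All (λ ((j′ , _) , _) → j′ ≡ j)

      ZeroOn⇔Zeros : ∀ {i j} {r : List ((Fin m × Y) × Fin s)} → LabelledBy j r → j ≡ i → ZeroOn i r ⇔ Zeros r
      ZeroOn⇔Zeros {r = r} labelled refl = mk⇔ (to labelled) (from labelled)
        where
        to : ∀ {r} → LabelledBy _ r → ZeroOn _ r → Zeros r
        to []       []       = []
        to (l ∷ ls) (z ∷ zs) = z l ∷ to ls zs
        from : ∀ {r} → LabelledBy _ r → Zeros r → ZeroOn _ r
        from []       []       = []
        from (l ∷ ls) (z ∷ zs) = (λ _ → z) ∷ from ls zs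

      ZeroOn-other : ∀ {i j} {r : List ((Fin m × Y) × Fin s)} → LabelledBy j r → ¬ j ≡ i → ZeroOn i r
      ZeroOn-other []       j≢i = []
      ZeroOn-other (l ∷ ls) j≢i = (λ j′≡i → ⊥-elim (j≢i (trans (sym l) j′≡i))) ∷ ZeroOn-other ls j≢i

      ZeroOn-concatBlocks : ∀ k (rs : Fin k → List ((Fin m × Y) × Fin s)) i → ZeroOn i (concatBlocks k rs) ⇔ (∀ j → ZeroOn i (rs j))
      ZeroOn-concatBlocks zero    rs i = mk⇔ (λ _ ()) (λ _ → [])
      ZeroOn-concatBlocks (suc k) rs i = mk⇔
        (λ zs → λ { zero → ++⁻ˡ (rs zero) zs ; (suc j) → Equivalence.to (ZeroOn-concatBlocks k (rs ∘ suc) i) (++⁻ʳ (rs zero) zs) j })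
        (λ zs → ++⁺ (zs zero) (Equivalence.from (ZeroOn-concatBlocks k (rs ∘ suc) i) (zs ∘ suc)))

      ZeroOn-blocks : (rs : Fin m → List ((Fin m × Y) × Fin s)) → (∀ j → LabelledBy j (rs j)) → ∀ i →
                      ZeroOn i (concatBlocks m rs) ⇔ Zeros (rs i)
      ZeroOn-blocks rs labelled i = mk⇔
        (λ z → Equivalence.to (ZeroOn⇔Zeros (labelled i) refl) (Equivalence.to (ZeroOn-concatBlocks m rs i) z i))
        (λ zs → Equivalence.from (ZeroOn-concatBlocks m rs i) λ j → on-block j (j ≟ i) zs)
        where
        on-block : ∀ j → Dec (j ≡ i) → Zeros (rs i) → ZeroOn i (rs j)
        on-block j (yes refl) zs = Equivalence.from (ZeroOn⇔Zeros (labelled j) refl) zs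
        on-block j (no j≢i)   _  = ZeroOn-other (labelled j) j≢i

    labels-All : ∀ {X Y A : Set} {P : X → Set} (h : Y → X) (r : List (X × A)) (L : List Y) → map proj₁ r ≡ map h L →
                 (∀ y → P (h y)) → All (P ∘ proj₁) r
    labels-All h []      []      _      _  = []
    labels-All h (p ∷ r) (y ∷ L) labels Ph = subst _ (sym (∷-injectiveˡ labels)) (Ph y) ∷ labels-All h r L (∷-injectiveʳ labels) Ph

    BGLabel SGLabel : Set
    BGLabel = Fin m × Fin n
    SGLabel = Fin m × (Fin n × Fin n)

    bgBlock : Fin m → List BGLabel
    bgBlock j = map (j ,_) (hs j)

    sgBlock : Fin m → List SGLabel
    sgBlock = sgEdgesOf hs ch

    apex : Fin m → Fin n
    apex j = lookup (hs j) (ch j)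

    sgLabel : Fin m → Fin n → SGLabel
    sgLabel j w = j , (w , apex j)

    -- the values on the BG block of hyperedge j determined by values on its SG edges:
    -- the edge to the apex carries minus the total of the others
    toBG : Fin m → List (SGLabel × Fin s) → List (BGLabel × Fin s)
    toBG j r = relabel (j ,_) (insertAt′ (toℕ (ch j)) (apex j , ⊖ total r) (relabel (proj₁ ∘ proj₂) r))

    balanced? : ∀ {X : Set} (r : List (X × Fin s)) → Dec (total r ≡ 𝟘)
    balanced? r = total r ≟ 𝟘

    block-transfer : ∀ j (g : List (BGLabel × Fin s) → ℕ) →
                     ∑ˡ (bgBlock j) (λ r → 𝟙 (balanced? r) * g r) ≡ ∑ˡ (sgBlock j) (g ∘ toBG j)
    block-transfer j g = begin
      ∑ˡ (map (j ,_) (hs j)) (λ r → 𝟙 (balanced? r) * g r)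
        ≡⟨ ∑ˡ-map (j ,_) (hs j) _ ⟩
      ∑ˡ (hs j) (λ r → 𝟙 (balanced? (relabel (j ,_) r)) * g (relabel (j ,_) r))
        ≡⟨ ∑ˡ-removeAt (hs j) (ch j) _ ⟩
      ∑[ a < s ] ∑ˡ others (λ r → 𝟙 (balanced? (relabel (j ,_) (insert a r))) * g (relabel (j ,_) (insert a r)))
        ≡⟨ ∑-cong {s} (λ a → ∑ˡ-cong others λ r _ → cong (_* g (relabel (j ,_) (insert a r)))
                         (𝟙-cong (trans (sym (total-insert a r))) (trans (total-insert a r))
                                 (balanced? (relabel (j ,_) (insert a r))) (a ⊕ total r ≟ 𝟘))) ⟩
      ∑[ a < s ] ∑ˡ others (λ r → 𝟙 (a ⊕ total r ≟ 𝟘) * g (relabel (j ,_) (insert a r)))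
        ≡⟨ sym (∑ˡ-∑ others (λ a r → 𝟙 (a ⊕ total r ≟ 𝟘) * g (relabel (j ,_) (insert a r)))) ⟩
      ∑ˡ others (λ r → ∑[ a < s ] (𝟙 (a ⊕ total r ≟ 𝟘) * g (relabel (j ,_) (insert a r))))
        ≡⟨ ∑ˡ-cong others (λ r _ → ∑-δ-⊖ (total r) (λ a → g (relabel (j ,_) (insert a r)))) ⟩
      ∑ˡ others (λ r → g (relabel (j ,_) (insert (⊖ total r) r)))
        ≡⟨ ∑ˡ-cong others (λ r _ → cong g (sym (toBG-relabel r))) ⟩
      ∑ˡ others (λ r → g (toBG j (relabel (sgLabel j) r)))
        ≡⟨ sym (∑ˡ-map (sgLabel j) others _) ⟩
      ∑ˡ (sgBlock j) (g ∘ toBG j) ∎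
      where
      open ≡-Reasoning
      others = removeAt (hs j) (ch j)
      insert : Fin s → List (Fin n × Fin s) → List (Fin n × Fin s)
      insert a = insertAt′ (toℕ (ch j)) (apex j , a)
      total-insert : ∀ a r → total (relabel (j ,_) (insert a r)) ≡ a ⊕ total r
      total-insert a r = trans (listSum-relabel (j ,_) (insert a r) proj₂) (listSum-insertAt′ (toℕ (ch j)) (apex j , a) r proj₂)
      relabel-relabel : ∀ (r : List (Fin n × Fin s)) → relabel (proj₁ ∘ proj₂) (relabel (sgLabel j) r) ≡ r
      relabel-relabel []      = refl
      relabel-relabel (p ∷ r) = cong (p ∷_) (relabel-relabel r)
      toBG-relabel : ∀ r → toBG j (relabel (sgLabel j) r) ≡ relabel (j ,_) (insert (⊖ total r) r)
      toBG-relabel r = cong₂ (λ t r′ → relabel (j ,_) (insertAt′ (toℕ (ch j)) (apex j , ⊖ t) r′))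
                             (listSum-relabel (sgLabel j) r proj₂) (relabel-relabel r)

    inflowAt : Fin n → List (BGLabel × Fin s) → Fin s
    inflowAt v r = listSum r (λ ((_ , w) , a) → [ w ≟ v ]· a)

    outflowAt : Fin m → List (BGLabel × Fin s) → Fin s
    outflowAt i r = listSum r (λ ((j , _) , a) → [ j ≟ i ]· a)

    netAt : Fin n → List (SGLabel × Fin s) → Fin s
    netAt v r = listSum r (λ ((_ , ends) , a) → incidence ends v a)

    NowhereZeroˡ : ∀ {Y : Set} → List ((Fin m × Y) × Fin s) → Set
    NowhereZeroˡ r = ∀ i → ¬ ZeroOn i r

    nowhereZeroˡ? : ∀ {Y : Set} (r : List ((Fin m × Y) × Fin s)) → Dec (NowhereZeroˡ r)
    nowhereZeroˡ? r = all? (λ i → ¬? (zeroOn? i r))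

    VertexBalanced : List (BGLabel × Fin s) → Set
    VertexBalanced r = ∀ v → inflowAt v r ≡ 𝟘

    IsNZFlowᴮᴳ : List (BGLabel × Fin s) → Set
    IsNZFlowᴮᴳ r = VertexBalanced r × (∀ i → outflowAt i r ≡ 𝟘) × NowhereZeroˡ r

    isNZFlowᴮᴳ? : ∀ r → Dec (IsNZFlowᴮᴳ r)
    isNZFlowᴮᴳ? r = all? (λ v → inflowAt v r ≟ 𝟘) ×-dec all? (λ i → outflowAt i r ≟ 𝟘) ×-dec nowhereZeroˡ? r

    IsNZFlowˢᴳ : List (SGLabel × Fin s) → Set
    IsNZFlowˢᴳ r = (∀ v → netAt v r ≡ 𝟘) × NowhereZeroˡ r

    isNZFlowˢᴳ? : ∀ r → Dec (IsNZFlowˢᴳ r)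
    isNZFlowˢᴳ? r = all? (λ v → netAt v r ≟ 𝟘) ×-dec nowhereZeroˡ? r

    balancedNZ? : ∀ r → Dec (VertexBalanced r × NowhereZeroˡ r)
    balancedNZ? r = all? (λ v → inflowAt v r ≟ 𝟘) ×-dec nowhereZeroˡ? r

    outflowAt-labelled : ∀ {i j} {r : List (BGLabel × Fin s)} → LabelledBy j r → outflowAt i r ≡ [ j ≟ i ]· total r
    outflowAt-labelled {i} {j} {r} labelled = begin
      listSum r (λ ((j′ , _) , a) → [ j′ ≟ i ]· a) ≡⟨ listSum-congᴬ labelled (λ { _ refl → refl }) ⟩
      listSum r (λ (_ , a) → [ j ≟ i ]· a)         ≡⟨ sym (listSum-hom [ j ≟ i ]·_ (·-𝟘 (j ≟ i)) (·-⊕ (j ≟ i)) r proj₂) ⟩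
      [ j ≟ i ]· total r                           ∎
      where open ≡-Reasoning

    LabelledBy-toBG : ∀ j r → LabelledBy j (toBG j r)
    LabelledBy-toBG j r = go (insertAt′ (toℕ (ch j)) (apex j , ⊖ total r) (relabel (proj₁ ∘ proj₂) r))
      where
      go : ∀ r′ → LabelledBy j (relabel (j ,_) r′)
      go []       = []
      go (p ∷ r′) = refl ∷ go r′

    SGLabelledBy : Fin m → List (SGLabel × Fin s) → Set
    SGLabelledBy j = All (λ ((j′ , (_ , x)) , _) → j′ ≡ j × x ≡ apex j)

    inflowAt-toBG : ∀ v j r → SGLabelledBy j r → inflowAt v (toBG j r) ≡ netAt v r
    inflowAt-toBG v j r labelled = begin
      inflowAt v (toBG j r)
        ≡⟨ listSum-relabel (j ,_) (insertAt′ (toℕ (ch j)) (apex j , ⊖ total r) (relabel (proj₁ ∘ proj₂) r)) _ ⟩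
      listSum (insertAt′ (toℕ (ch j)) (apex j , ⊖ total r) (relabel (proj₁ ∘ proj₂) r)) (λ (w , a) → [ w ≟ v ]· a)
        ≡⟨ listSum-insertAt′ (toℕ (ch j)) (apex j , ⊖ total r) (relabel (proj₁ ∘ proj₂) r) _ ⟩
      [ apex j ≟ v ]· (⊖ total r) ⊕ listSum (relabel (proj₁ ∘ proj₂) r) (λ (w , a) → [ w ≟ v ]· a)
        ≡⟨ cong₂ _⊕_ (trans (·-⊖ (apex j ≟ v) (total r))
                            (cong ⊖_ (listSum-hom [ apex j ≟ v ]·_ (·-𝟘 (apex j ≟ v)) (·-⊕ (apex j ≟ v)) r proj₂)))
                     (listSum-relabel (proj₁ ∘ proj₂) r _) ⟩
      ⊖ listSum r (λ (_ , a) → [ apex j ≟ v ]· a) ⊕ listSum r (λ ((_ , (w , _)) , a) → [ w ≟ v ]· a)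
        ≡⟨ comm _ _ ⟩
      listSum r (λ ((_ , (w , _)) , a) → [ w ≟ v ]· a) ⊕ ⊖ listSum r (λ (_ , a) → [ apex j ≟ v ]· a)
        ≡⟨ cong (listSum r (λ ((_ , (w , _)) , a) → [ w ≟ v ]· a) ⊕_) (listSum-hom ⊖_ ε⁻¹≈ε ⊖-⊕ r _) ⟩
      listSum r (λ ((_ , (w , _)) , a) → [ w ≟ v ]· a) ⊕ listSum r (λ (_ , a) → ⊖ [ apex j ≟ v ]· a)
        ≡⟨ sym (listSum-⊕ r _ _) ⟩
      listSum r (λ ((_ , (w , _)) , a) → [ w ≟ v ]· a ⊕ ⊖ [ apex j ≟ v ]· a)
        ≡⟨ listSum-congᴬ labelled (λ { _ (_ , refl) → refl }) ⟩
      netAt v r ∎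
      where open ≡-Reasoning

    Zeros-toBG : ∀ j r → Zeros (toBG j r) ⇔ Zeros r
    Zeros-toBG j r = mk⇔
      (λ zs → Equivalence.to (Zeros-relabel (proj₁ ∘ proj₂) r)
                (proj₂ (Equivalence.to (Zeros-insertAt′ (toℕ (ch j)) (apex j , ⊖ total r) _) (Equivalence.to (Zeros-relabel (j ,_) _) zs))))
      (λ zs → Equivalence.from (Zeros-relabel (j ,_) _) (Equivalence.from (Zeros-insertAt′ (toℕ (ch j)) (apex j , ⊖ total r) _)
                (trans (cong ⊖_ (total-Zeros r zs)) ε⁻¹≈ε , Equivalence.from (Zeros-relabel (proj₁ ∘ proj₂) r) zs)))

    module _ (rs : Fin m → List (BGLabel × Fin s)) (labels : ∀ j → map proj₁ (rs j) ≡ bgBlock j) where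

      private
        labelled : ∀ j → LabelledBy j (rs j)
        labelled j = labels-All (j ,_) (rs j) (hs j) (labels j) (λ _ → refl)

        outflowAt-blocks : ∀ i → outflowAt i (concatBlocks m rs) ≡ total (rs i)
        outflowAt-blocks i = trans (listSum-concatBlocks m rs _)
          (trans (∑ᴳ-cong m (λ j → outflowAt-labelled (labelled j))) (∑ᴳ-δ m i (total ∘ rs)))

      𝟙-isNZFlowᴮᴳ-blocks : 𝟙 (isNZFlowᴮᴳ? (concatBlocks m rs)) ≡ 𝟙 (all? (balanced? ∘ rs)) * 𝟙 (balancedNZ? (concatBlocks m rs))
      𝟙-isNZFlowᴮᴳ-blocks = trans
        (𝟙-cong (λ (in≡𝟘 , out≡𝟘 , nz) → (λ j → trans (sym (outflowAt-blocks j)) (out≡𝟘 j)) , in≡𝟘 , nz)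
                (λ (balanced , in≡𝟘 , nz) → in≡𝟘 , (λ i → trans (outflowAt-blocks i) (balanced i)) , nz)
                (isNZFlowᴮᴳ? (concatBlocks m rs)) (all? (balanced? ∘ rs) ×-dec balancedNZ? (concatBlocks m rs)))
        (𝟙-× (all? (balanced? ∘ rs)) (balancedNZ? (concatBlocks m rs)))

    module _ (rs : Fin m → List (SGLabel × Fin s)) (labels : ∀ j → map proj₁ (rs j) ≡ sgBlock j) where

      private
        bg : Fin m → List (BGLabel × Fin s)
        bg j = toBG j (rs j)

        labelled : ∀ j → SGLabelledBy j (rs j)
        labelled j = labels-All (sgLabel j) (rs j) (removeAt (hs j) (ch j)) (labels j) (λ _ → refl , refl)

        inflow≡net : ∀ v → inflowAt v (concatBlocks m bg) ≡ netAt v (concatBlocks m rs)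
        inflow≡net v = trans (listSum-concatBlocks m bg _)
          (trans (∑ᴳ-cong m (λ j → inflowAt-toBG v j (rs j) (labelled j))) (sym (listSum-concatBlocks m rs _)))

        ZeroOn-toBG : ∀ i → ZeroOn i (concatBlocks m bg) ⇔ ZeroOn i (concatBlocks m rs)
        ZeroOn-toBG i = mk⇔
          (λ z → Equivalence.from (ZeroOn-blocks rs sg-labelled i)
                   (Equivalence.to (Zeros-toBG i (rs i)) (Equivalence.to (ZeroOn-blocks bg (λ j → LabelledBy-toBG j (rs j)) i) z)))
          (λ z → Equivalence.from (ZeroOn-blocks bg (λ j → LabelledBy-toBG j (rs j)) i)
                   (Equivalence.from (Zeros-toBG i (rs i)) (Equivalence.to (ZeroOn-blocks rs sg-labelled i) z)))
          where
          sg-labelled : ∀ j → LabelledBy j (rs j)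
          sg-labelled j = All.map proj₁ (labelled j)

      𝟙-balancedNZ-toBG : 𝟙 (balancedNZ? (concatBlocks m bg)) ≡ 𝟙 (isNZFlowˢᴳ? (concatBlocks m rs))
      𝟙-balancedNZ-toBG = 𝟙-cong
        (λ (in≡𝟘 , nz) → (λ v → trans (sym (inflow≡net v)) (in≡𝟘 v)) , λ i → nz i ∘ Equivalence.from (ZeroOn-toBG i))
        (λ (net≡𝟘 , nz) → (λ v → trans (inflow≡net v) (net≡𝟘 v)) , λ i → nz i ∘ Equivalence.to (ZeroOn-toBG i))
        _ _

    -- BG and SG flows correspond block by block: a BG block balances exactly when it is
    -- the image under toBG of the SG block obtained by dropping the edge to the apex.
    transfer : ∑ˡ (bgEdges hs) (𝟙 ∘ isNZFlowᴮᴳ?) ≡ ∑ˡ (sgEdges hs ch) (𝟙 ∘ isNZFlowˢᴳ?)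
    transfer = begin
      ∑ˡ (bgEdges hs) (𝟙 ∘ isNZFlowᴮᴳ?)
        ≡⟨ cong (λ L → ∑ˡ L (𝟙 ∘ isNZFlowᴮᴳ?)) (concatMap-tabulate bgBlock (λ j → j)) ⟩
      ∑ˡ (concatBlocks m bgBlock) (𝟙 ∘ isNZFlowᴮᴳ?)
        ≡⟨ ∑ˡ-concatBlocks m bgBlock _ ⟩
      ∑ᴮ m bgBlock (λ rs → 𝟙 (isNZFlowᴮᴳ? (concatBlocks m rs)))
        ≡⟨ ∑ᴮ-cong m bgBlock 𝟙-isNZFlowᴮᴳ-blocks ⟩
      ∑ᴮ m bgBlock (λ rs → 𝟙 (all? (balanced? ∘ rs)) * 𝟙 (balancedNZ? (concatBlocks m rs)))
        ≡⟨ ∑ᴮ-reparametrise balanced? m bgBlock sgBlock toBG block-transfer _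
             (λ rs rs′ rs≡rs′ → cong (𝟙 ∘ balancedNZ?) (concatBlocks-cong m rs≡rs′)) ⟩
      ∑ᴮ m sgBlock (λ rs → 𝟙 (balancedNZ? (concatBlocks m (λ j → toBG j (rs j)))))
        ≡⟨ ∑ᴮ-cong m sgBlock 𝟙-balancedNZ-toBG ⟩
      ∑ᴮ m sgBlock (λ rs → 𝟙 (isNZFlowˢᴳ? (concatBlocks m rs)))
        ≡⟨ sym (∑ˡ-concatBlocks m sgBlock _) ⟩
      ∑ˡ (concatBlocks m sgBlock) (𝟙 ∘ isNZFlowˢᴳ?)
        ≡⟨ cong (λ L → ∑ˡ L (𝟙 ∘ isNZFlowˢᴳ?)) (sym (concatMap-tabulate sgBlock (λ j → j))) ⟩
      ∑ˡ (sgEdges hs ch) (𝟙 ∘ isNZFlowˢᴳ?) ∎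
      where open ≡-Reasoning

    listSum-zipLabels : ∀ {X : Set} (L : List X) (v : Vec (Fin s) (length L)) (h : X → Fin s → Fin s) →
                        listSum (zipLabels L v) (λ (x , a) → h x a) ≡ ∑ᴳ (length L) (λ e → h (lookup L e) (Vec.lookup v e))
    listSum-zipLabels []      []      h = refl
    listSum-zipLabels (x ∷ L) (a ∷ v) h = cong (h x a ⊕_) (listSum-zipLabels L v h)

    All-zipLabels : ∀ {X : Set} {P : X × Fin s → Set} (L : List X) (v : Vec (Fin s) (length L)) →
                    All P (zipLabels L v) ⇔ (∀ e → P (lookup L e , Vec.lookup v e))
    All-zipLabels []      []      = mk⇔ (λ _ ()) (λ _ → [])
    All-zipLabels (x ∷ L) (a ∷ v) = mk⇔ (λ { (p ∷ ps) zero → p ; (p ∷ ps) (suc e) → Equivalence.to (All-zipLabels L v) ps e })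
                                        (λ ps → ps zero ∷ Equivalence.from (All-zipLabels L v) (ps ∘ suc))

module Characteristic where

  open import Data.Nat using (ℕ; zero; suc; _+_; _∸_; _^_; _≤_; pred)
  open import Data.Nat.Properties using (+-comm; +-assoc; +-suc; +-commutativeSemigroup; ∸-+-assoc; m+[n∸m]≡n; [m+n]∸[m+o]≡n∸o; n≤0⇒n≡0; +-mono-≤; module ≤-Reasoning)
  open import Algebra.Properties.CommutativeSemigroup +-commutativeSemigroup using (x∙yz≈y∙xz)
  import Data.Integer as ℤ
  open import Data.Fin using (Fin; zero; suc; _≟_)
  open import Data.Fin.Properties using (all?)
  open import Data.Fin.Subset using (Subset; _∈_; _∉_; ∣_∣; ∁; ⊤; ⊥; _∩_)
  open import Data.Fin.Subset.Properties using (p⊆q⇒∣p∣≤∣q∣; x∈∁p⇒x∉p; x∉∁p⇒x∈p; p∩q⊆p; p∩q⊆q)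
  open import Data.Bool using (Bool; true; false; if_then_else_)
  import Data.Bool as Bool
  open import Data.Vec using ([]; _∷_)
  import Data.Vec as Vec
  open import Data.Vec.Properties using (lookup∘tabulate; []=⇒lookup; lookup⇒[]=)
  open import Data.List using (List; []; _∷_; length; filter; removeAt; lookup)
  open import Data.List.Properties using (length-removeAt)
  open import Data.Product using (_×_; _,_; proj₁)
  open import Function using (_∘_; _⇔_; mk⇔; Equivalence)
  open import Relation.Nullary using (_×-dec_)
  open import Relation.Binary.PropositionalEquality using (_≡_; refl; sym; trans; cong; cong₂; subst; module ≡-Reasoning)
  open import Defs
  open Counting
  open InclusionExclusion using (inclusion-exclusion; allIn?; ∑ℤ-cong; sgn)
  open FinGroup using (FinAbelianGroup; module FinGroupSums)
  open GraphFlows using (module Flows)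
  open Hypergraph using (module Transfer)

  ∣tabulate∣≡count : ∀ {X : Set} (g : X → Bool) (L : List X) →
                     ∣ Vec.tabulate {n = length L} (λ e → g (lookup L e)) ∣ ≡ length (filter (λ x → g x Bool.≟ true) L)
  ∣tabulate∣≡count g []      = refl
  ∣tabulate∣≡count g (x ∷ L) with g x
  ... | true  = cong suc (∣tabulate∣≡count g L)
  ... | false = ∣tabulate∣≡count g L

  length-filter-const : ∀ {X : Set} (g : X → Bool) {b} (L : List X) → (∀ x → g x ≡ b) →
                        length (filter (λ x → g x Bool.≟ true) L) ≡ (if b then length L else 0)
  length-filter-const g         []      g≡b = sym (if-const _)
    where if-const : ∀ b → (if b then 0 else 0) ≡ 0
          if-const true = refl ; if-const false = refl
  length-filter-const g {true}  (x ∷ L) g≡b rewrite g≡b x = cong suc (length-filter-const g L g≡b)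
  length-filter-const g {false} (x ∷ L) g≡b rewrite g≡b x = length-filter-const g L g≡b

  sumOver-∑ : ∀ {m} (S : Subset m) (f : Fin m → ℕ) → sumOver S f ≡ ∑[ j < m ] (if Vec.lookup S j then f j else 0)
  sumOver-∑ []          f = refl
  sumOver-∑ (true  ∷ S) f = cong (f zero +_) (sumOver-∑ S (f ∘ suc))
  sumOver-∑ (false ∷ S) f = sumOver-∑ S (f ∘ suc)

  sumOver-∁ : ∀ {m} (T : Subset m) (f : Fin m → ℕ) → sumOver ⊤ f ≡ sumOver T f + sumOver (∁ T) f
  sumOver-∁ []          f = refl
  sumOver-∁ (true  ∷ T) f = trans (cong (f zero +_) (sumOver-∁ T (f ∘ suc))) (sym (+-assoc (f zero) _ _))
  sumOver-∁ (false ∷ T) f = trans (cong (f zero +_) (sumOver-∁ T (f ∘ suc))) (x∙yz≈y∙xz (f zero) (sumOver T (f ∘ suc)) (sumOver (∁ T) (f ∘ suc)))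

  sumOver-⊥ : ∀ {m} (f : Fin m → ℕ) → sumOver ⊥ f ≡ 0
  sumOver-⊥ {zero}  f = refl
  sumOver-⊥ {suc m} f = sumOver-⊥ (f ∘ suc)

  ∁⊤≡⊥ : ∀ {m} → ∁ (⊤ {m}) ≡ ⊥
  ∁⊤≡⊥ {zero}  = refl
  ∁⊤≡⊥ {suc m} = cong (false ∷_) ∁⊤≡⊥

  ∸-∸-cancel : ∀ m {n o} → o ≤ n → (m ∸ o) ∸ (n ∸ o) ≡ m ∸ n
  ∸-∸-cancel m {n} {o} o≤n = trans (∸-+-assoc m o (n ∸ o)) (cong (m ∸_) (m+[n∸m]≡n o≤n))

  module _ {N n : ℕ} {ends : Fin N → Fin n × Fin n} where

    rank≤card : ∀ {A ρ} → IsCycleRank ends A ρ → ρ ≤ ∣ A ∣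
    rank≤card ((F , F⊆A , _ , ∣F∣≡ρ) , _) = subst (_≤ _) ∣F∣≡ρ (p⊆q⇒∣p∣≤∣q∣ F⊆A)

    rank-subadditive : ∀ {A B C ρA ρB} → IsCycleRank ends A ρA → IsCycleRank ends B ρB →
                       (∀ {e} → e ∈ A → e ∉ B → e ∈ C) → ρA ≤ ρB + ∣ C ∣
    rank-subadditive {A} {B} {C} {ρA} {ρB} ((F , F⊆A , acyclic , ∣F∣≡ρA) , _) (_ , maximumB) A⊆B∪C = begin
      ρA                        ≡⟨ sym ∣F∣≡ρA ⟩
      ∣ F ∣                     ≡⟨ ∣p∣≡∣p∩q∣+∣p∩∁q∣ F B ⟩
      ∣ F ∩ B ∣ + ∣ F ∩ ∁ B ∣   ≤⟨ +-mono-≤ (maximumB (F ∩ B) (p∩q⊆q F B) (λ c c⊆ → acyclic c (p∩q⊆p F B ∘ c⊆)))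
                                            (p⊆q⇒∣p∣≤∣q∣ λ e∈ → A⊆B∪C (F⊆A (p∩q⊆p F (∁ B) e∈))
                                                                         (x∈∁p⇒x∉p (p∩q⊆q F (∁ B) e∈))) ⟩
      ρB + ∣ C ∣                ∎
      where
      open ≤-Reasoning
      ∣p∣≡∣p∩q∣+∣p∩∁q∣ : ∀ {k} (p q : Subset k) → ∣ p ∣ ≡ ∣ p ∩ q ∣ + ∣ p ∩ ∁ q ∣
      ∣p∣≡∣p∩q∣+∣p∩∁q∣ []         []         = refl
      ∣p∣≡∣p∩q∣+∣p∩∁q∣ (true  ∷ p) (true  ∷ q) = cong suc (∣p∣≡∣p∩q∣+∣p∩∁q∣ p q)
      ∣p∣≡∣p∩q∣+∣p∩∁q∣ (true  ∷ p) (false ∷ q) = trans (cong suc (∣p∣≡∣p∩q∣+∣p∩∁q∣ p q)) (sym (+-suc _ _))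
      ∣p∣≡∣p∩q∣+∣p∩∁q∣ (false ∷ p) (true  ∷ q) = ∣p∣≡∣p∩q∣+∣p∩∁q∣ p q
      ∣p∣≡∣p∩q∣+∣p∩∁q∣ (false ∷ p) (false ∷ q) = ∣p∣≡∣p∩q∣+∣p∩∁q∣ p q

  module _ {n m : ℕ} (hs : Hyp n m) (ch : Choice hs) where

    private
      N = length (sgEdges hs ch)

    label : Fin N → Fin m
    label e = proj₁ (lookup (sgEdges hs ch) e)

    ∈sgSub⇔ : ∀ S {e} → e ∈ sgSub hs ch S ⇔ label e ∈ S
    ∈sgSub⇔ S {e} = mk⇔ (λ e∈ → lookup⇒[]= (label e) S (trans (sym (lookup∘tabulate _ e)) ([]=⇒lookup e∈)))
                        (λ l∈ → lookup⇒[]= e (sgSub hs ch S) (trans (lookup∘tabulate _ e) ([]=⇒lookup l∈)))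

    ∣sgSub∣ : ∀ S → ∣ sgSub hs ch S ∣ ≡ sumOver S (aVec hs)
    ∣sgSub∣ S = begin
      ∣ sgSub hs ch S ∣
        ≡⟨ ∣tabulate∣≡count (Vec.lookup S ∘ proj₁) (sgEdges hs ch) ⟩
      length (filter inS? (sgEdges hs ch))
        ≡⟨ cong (length ∘ filter inS?) (concatMap-tabulate (sgEdgesOf hs ch) (λ j → j)) ⟩
      length (filter inS? (concatBlocks m (sgEdgesOf hs ch)))
        ≡⟨ length-filter-concatBlocks inS? m (sgEdgesOf hs ch) ⟩
      ∑[ j < m ] length (filter inS? (sgEdgesOf hs ch j))
        ≡⟨ ∑-cong {m} block ⟩
      ∑[ j < m ] (if Vec.lookup S j then aVec hs j else 0)
        ≡⟨ sym (sumOver-∑ S (aVec hs)) ⟩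
      sumOver S (aVec hs) ∎
      where
      open ≡-Reasoning
      inS? = λ (x : Fin m × (Fin n × Fin n)) → Vec.lookup S (proj₁ x) Bool.≟ true
      block : ∀ j → length (filter inS? (sgEdgesOf hs ch j)) ≡ (if Vec.lookup S j then aVec hs j else 0)
      block j = trans (length-filter-map inS? (λ w → j , (w , lookup (hs j) (ch j))) (removeAt (hs j) (ch j)))
                (trans (length-filter-const (λ _ → Vec.lookup S j) (removeAt (hs j) (ch j)) (λ _ → refl))
                       (cong (λ k → if Vec.lookup S j then k else 0) (trans (length-removeAt (hs j) (ch j)) (pred≡∸1 (length (hs j))))))
        where pred≡∸1 : ∀ k → pred k ≡ k ∸ 1
              pred≡∸1 zero = refl ; pred≡∸1 (suc k) = refl

    module _ (r : Subset m → ℕ) (isRank : IsRankPH hs ch r) where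

      -- truncated subtraction is harmless here: r E ≤ r (∁ T) + Σ_{x∈T} a_x by subadditivity
      exponent : ∀ T → ∣ sgSub hs ch (∁ T) ∣ ∸ r (∁ T) ≡ dualRank r (aVec hs) ⊤ ∸ dualRank r (aVec hs) T
      exponent T = sym (begin
        ((r (∁ ⊤) + sumOver ⊤ a) ∸ r ⊤) ∸ ((r (∁ T) + sumOver T a) ∸ r ⊤)
          ≡⟨ cong (λ x → ((x + sumOver ⊤ a) ∸ r ⊤) ∸ ((r (∁ T) + sumOver T a) ∸ r ⊤)) r∅≡0 ⟩
        (sumOver ⊤ a ∸ r ⊤) ∸ ((r (∁ T) + sumOver T a) ∸ r ⊤)
          ≡⟨ ∸-∸-cancel (sumOver ⊤ a) rE≤ ⟩
        sumOver ⊤ a ∸ (r (∁ T) + sumOver T a)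
          ≡⟨ cong₂ _∸_ (sumOver-∁ T a) (+-comm (r (∁ T)) _) ⟩
        (sumOver T a + sumOver (∁ T) a) ∸ (sumOver T a + r (∁ T))
          ≡⟨ [m+n]∸[m+o]≡n∸o (sumOver T a) _ _ ⟩
        sumOver (∁ T) a ∸ r (∁ T)
          ≡⟨ cong (_∸ r (∁ T)) (sym (∣sgSub∣ (∁ T))) ⟩
        ∣ sgSub hs ch (∁ T) ∣ ∸ r (∁ T) ∎)
        where
        open ≡-Reasoning
        a = aVec hs
        r∅≡0 : r (∁ ⊤) ≡ 0
        r∅≡0 = n≤0⇒n≡0 (subst (r (∁ ⊤) ≤_) (trans (∣sgSub∣ (∁ ⊤)) (trans (cong (λ S → sumOver S a) ∁⊤≡⊥) (sumOver-⊥ a)))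
                                           (rank≤card (isRank (∁ ⊤))))
        rE≤ : r ⊤ ≤ r (∁ T) + sumOver T a
        rE≤ = subst (λ k → r ⊤ ≤ r (∁ T) + k) (∣sgSub∣ T) (rank-subadditive (isRank ⊤) (isRank (∁ T))
                λ _ e∉A → Equivalence.from (∈sgSub⇔ T) (x∉∁p⇒x∈p (e∉A ∘ Equivalence.from (∈sgSub⇔ (∁ T)))))

  module _ {s : ℕ} (𝔾 : FinAbelianGroup s) {n m : ℕ} (hs : Hyp n m) (ch : Choice hs) where

    open FinGroupSums 𝔾
    open SumsOver s
    open Transfer 𝔾 hs ch
    open Flows 𝔾 (sgEnds hs ch)

    private
      SG = sgEdges hs ch

    netAt-zipLabels : ∀ v x → netAt x (zipLabels SG v) ≡ net v x
    netAt-zipLabels v x = listSum-zipLabels SG v (λ (_ , ends) a → incidence ends x a)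

    #flows-∁ : ∀ T → ∑ˡ SG (λ r → 𝟙 (all? (λ x → netAt x r ≟ 𝟘) ×-dec allIn? T zeroOn? r)) ≡ #flows (sgSub hs ch (∁ T))
    #flows-∁ T = trans (sym (∑ᵛ-zipLabels SG _)) (∑ᵛ-cong (length SG) λ v → 𝟙-cong
      (λ (balanced , zeroOn) → supported v zeroOn , λ x → trans (sym (netAt-zipLabels v x)) (balanced x))
      (λ (supp , flow) → (λ x → trans (netAt-zipLabels v x) (flow x)) , zeroOn v supp)
      (all? (λ x → netAt x (zipLabels SG v) ≟ 𝟘) ×-dec allIn? T zeroOn? (zipLabels SG v)) (flowOn? (sgSub hs ch (∁ T)) v))
      where
      supported : ∀ v → (∀ i → i ∈ T → ZeroOn i (zipLabels SG v)) → SupportedOn (sgSub hs ch (∁ T)) v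
      supported v zeroOn e e∉A =
        Equivalence.to (All-zipLabels SG v) (zeroOn (label hs ch e) (x∉∁p⇒x∈p (e∉A ∘ Equivalence.from (∈sgSub⇔ hs ch (∁ T))))) e refl
      zeroOn : ∀ v → SupportedOn (sgSub hs ch (∁ T)) v → ∀ i → i ∈ T → ZeroOn i (zipLabels SG v)
      zeroOn v supp i i∈T = Equivalence.from (All-zipLabels SG v) λ { e refl →
        supp e λ e∈A → x∈∁p⇒x∉p (Equivalence.to (∈sgSub⇔ hs ch (∁ T)) e∈A) i∈T }

    #NZFlowsˢᴳ : (r : Subset m → ℕ) → IsRankPH hs ch r → ℤ.+ ∑ˡ SG (𝟙 ∘ isNZFlowˢᴳ?) ≡ charPoly (dualRank r (aVec hs)) s
    #NZFlowsˢᴳ r isRank = trans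
      (inclusion-exclusion (∑ˡ SG) (λ f≡g → ∑ˡ-cong SG (λ r _ → f≡g r)) (∑ˡ-+ SG) m (λ r → all? (λ x → netAt x r ≟ 𝟘)) zeroOn?)
      (∑ℤ-cong (allVecs (true ∷ false ∷ []) m) λ T → cong (λ k → sgn ∣ T ∣ ℤ.* ℤ.+ k)
        (trans (#flows-∁ T) (trans (#flows-rank _ (r (∁ T)) (isRank (∁ T))) (cong (s ^_) (exponent hs ch r isRank T)))))


open import Algebra.Bundles using (AbelianGroup; RawGroup)
open import Algebra.Morphism.Structures using (IsGroupMonomorphism)
open import Data.Nat as ℕ using (ℕ)
import Data.Fin as Fin
open import Data.Fin using (Fin; _≟_)
open import Data.Fin.Properties using (any?)
open import Data.List using (lookup)
open import Data.Vec using (Vec)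
import Data.Vec as Vec
open import Data.Product using (_×_; _,_; proj₁; proj₂)
open import Data.Sum using (inj₁; inj₂)
open import Data.Sum.Properties using (inj₁-injective; inj₂-injective)
open import Data.Bool using (if_then_else_)
open import Data.Empty using (⊥-elim)
open import Function using (_∘_; Equivalence)
open import Relation.Nullary using (Dec; yes; no; does)
open import Relation.Nullary.Decidable using (_×-dec_; ¬?)
open import Relation.Binary.PropositionalEquality using (_≡_; refl; sym; trans; cong; module ≡-Reasoning)
open import Data.Fin.Subset using (Subset)
open import Data.Integer using (+_)
open import Defs
open Counting
open FinGroup using (FinAbelianGroup; module FinGroupSums)
open Hypergraph using (module Transfer)
open Characteristic using (#NZFlowsˢᴳ)

module OnFin {c ℓ} (G : AbelianGroup c ℓ) (FG : FiniteEnum G) where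

  open AbelianGroup G using (Carrier; _≈_; _∙_; ε; _⁻¹; ∙-cong; reflexive; rawGroup)
    renaming (refl to ≈-refl; sym to ≈-sym; trans to ≈-trans; isAbelianGroup to G-isAbelianGroup)
  open FiniteEnum FG

  index : Carrier → Fin size
  index g = proj₁ (enum-surj g)

  enum-index : ∀ g → enum (index g) ≈ g
  enum-index g = proj₂ (enum-surj g)

  rawFinGroup : RawGroup _ _
  rawFinGroup = record
    { Carrier = Fin size ; _≈_ = _≡_ ; _∙_ = λ i j → index (enum i ∙ enum j) ; ε = index ε ; _⁻¹ = λ i → index (enum i ⁻¹) }

  enum-isGroupMonomorphism : IsGroupMonomorphism rawFinGroup rawGroup enum
  enum-isGroupMonomorphism = record
    { isGroupHomomorphism = record
      { isMonoidHomomorphism = record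
        { isMagmaHomomorphism = record
          { isRelHomomorphism = record { cong = reflexive ∘ cong enum }
          ; homo = λ i j → enum-index (enum i ∙ enum j) }
        ; ε-homo = enum-index ε }
      ; ⁻¹-homo = λ i → enum-index (enum i ⁻¹) }
    ; injective = enum-inj _ _ }

  finGroup : FinAbelianGroup size
  finGroup = record
    { isAbelianGroup = isAbelianGroup G-isAbelianGroup }
    where open import Algebra.Morphism.GroupMonomorphism enum-isGroupMonomorphism using (isAbelianGroup)

  open FinGroupSums finGroup
  open SumsOver size

  enum-sum : ∀ k (h : Fin k → Fin size) → sumG G FG (enum ∘ h) ≈ enum (∑ᴳ k h)
  enum-sum ℕ.zero    h = ≈-sym (enum-index ε)
  enum-sum (ℕ.suc k) h = ≈-trans (∙-cong ≈-refl (enum-sum k (h ∘ Fin.suc))) (≈-sym (enum-index _))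

  enum-when : ∀ {P Q : Set} (P? : Dec P) (Q? : Dec Q) → (P → Q) → (Q → P) → ∀ a → (if does P? then enum a else ε) ≈ enum ([ Q? ]· a)
  enum-when (yes _) (yes _) _ _ a = ≈-refl
  enum-when (yes p) (no ¬q) f _ a = ⊥-elim (¬q (f p))
  enum-when (no ¬p) (yes q) _ g a = ⊥-elim (¬p (g q))
  enum-when (no _)  (no _)  _ _ a = ≈-sym (enum-index ε)

  sumG-cong : ∀ {k} {f g : Fin k → Carrier} → (∀ e → f e ≈ g e) → sumG G FG f ≈ sumG G FG g
  sumG-cong {ℕ.zero}  f≈g = ≈-refl
  sumG-cong {ℕ.suc k} f≈g = ∙-cong (f≈g Fin.zero) (sumG-cong (f≈g ∘ Fin.suc))

  ≡𝟘⇒≈ε : ∀ {a} → a ≡ 𝟘 → enum a ≈ ε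
  ≡𝟘⇒≈ε refl = enum-index ε

  ≈ε⇒≡𝟘 : ∀ {a} → enum a ≈ ε → a ≡ 𝟘
  ≈ε⇒≡𝟘 a≈ε = enum-inj _ _ (≈-trans a≈ε (≈-sym (enum-index ε)))

  module _ {n m : ℕ} (hs : Hyp n m) (ch : Choice hs) (F : Vec (Fin size) (NB G FG hs)) where

    open Transfer finGroup hs ch

    private
      f : Fin (NB G FG hs) → Carrier
      f = enum ∘ Vec.lookup F
      r = zipLabels (bgEdges hs) F

      sumG-restricted : ∀ {P Q : Fin (NB G FG hs) → Set} (P? : ∀ e → Dec (P e)) (Q? : ∀ e → Dec (Q e)) →
                        (∀ e → P e → Q e) → (∀ e → Q e → P e) →
                        sumG G FG (λ e → if does (P? e) then f e else ε) ≈ enum (∑ᴳ _ (λ e → [ Q? e ]· Vec.lookup F e))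
      sumG-restricted P? Q? P⇒Q Q⇒P = ≈-trans (sumG-cong λ e → enum-when (P? e) (Q? e) (P⇒Q e) (Q⇒P e) (Vec.lookup F e))
                                              (enum-sum (NB G FG hs) (λ e → [ Q? e ]· Vec.lookup F e))

      inflow-vertex : ∀ v → inflow G FG hs f (inj₁ v) ≈ enum (inflowAt v r)
      inflow-vertex v = ≈-trans (sumG-restricted (λ e → node? G FG hs (head G FG hs e) (inj₁ v)) (λ e → proj₂ (lookup (bgEdges hs) e) ≟ v)
                                                 (λ _ → inj₁-injective) (λ _ → cong inj₁))
                                (reflexive (cong enum (sym (listSum-zipLabels (bgEdges hs) F (λ (_ , w) a → [ w ≟ v ]· a)))))

      outflow-hyperedge : ∀ i → outflow G FG hs f (inj₂ i) ≈ enum (outflowAt i r)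
      outflow-hyperedge i = ≈-trans (sumG-restricted (λ e → node? G FG hs (tail G FG hs e) (inj₂ i)) (λ e → proj₁ (lookup (bgEdges hs) e) ≟ i)
                                                     (λ _ → inj₂-injective) (λ _ → cong inj₂))
                                    (reflexive (cong enum (sym (listSum-zipLabels (bgEdges hs) F (λ (j , _) a → [ j ≟ i ]· a)))))

      sumG-ε : ∀ k → sumG G FG {k} (λ _ → ε) ≈ ε
      sumG-ε ℕ.zero    = ≈-refl
      sumG-ε (ℕ.suc k) = ≈-trans (∙-cong ≈-refl (sumG-ε k)) (AbelianGroup.identityˡ G ε)

    isFlow⇒ : IsFlow G FG hs f → VertexBalanced r × (∀ i → outflowAt i r ≡ 𝟘)
    isFlow⇒ flow = (λ v → ≈ε⇒≡𝟘 (≈-trans (≈-sym (inflow-vertex v)) (≈-trans (flow (inj₁ v)) (sumG-ε (NB G FG hs)))))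
                 , (λ i → ≈ε⇒≡𝟘 (≈-trans (≈-sym (outflow-hyperedge i)) (≈-trans (≈-sym (flow (inj₂ i))) (sumG-ε (NB G FG hs)))))

    isFlow⇐ : VertexBalanced r × (∀ i → outflowAt i r ≡ 𝟘) → IsFlow G FG hs f
    isFlow⇐ (in≡𝟘 , out≡𝟘) (inj₁ v) = ≈-trans (inflow-vertex v) (≈-trans (≡𝟘⇒≈ε (in≡𝟘 v)) (≈-sym (sumG-ε (NB G FG hs))))
    isFlow⇐ (in≡𝟘 , out≡𝟘) (inj₂ i) =
      ≈-trans (sumG-ε (NB G FG hs)) (≈-trans (≈-sym (≡𝟘⇒≈ε (out≡𝟘 i))) (≈-sym (outflow-hyperedge i)))

    nowhereZero⇒ : NowhereZero G FG hs f → NowhereZeroˡ r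
    nowhereZero⇒ nz i zeroOn with nz i
    ... | e , tail≡i , fe≉ε = fe≉ε (≡𝟘⇒≈ε (Equivalence.to (All-zipLabels (bgEdges hs) F) zeroOn e (inj₂-injective tail≡i)))

    nowhereZero⇐ : NowhereZeroˡ r → NowhereZero G FG hs f
    nowhereZero⇐ nz i with any? (λ e → proj₁ (lookup (bgEdges hs) e) ≟ i ×-dec ¬? (Vec.lookup F e ≟ 𝟘))
    ... | yes (e , label≡i , Fe≢𝟘) = e , cong inj₂ label≡i , Fe≢𝟘 ∘ ≈ε⇒≡𝟘
    ... | no none = ⊥-elim (nz i (Equivalence.from (All-zipLabels (bgEdges hs) F) λ e label≡i → zero-at e label≡i (Vec.lookup F e ≟ 𝟘)))
      where
      zero-at : ∀ e → proj₁ (lookup (bgEdges hs) e) ≡ i → Dec (Vec.lookup F e ≡ 𝟘) → Vec.lookup F e ≡ 𝟘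
      zero-at e _        (yes Fe≡𝟘) = Fe≡𝟘
      zero-at e label≡i (no Fe≢𝟘)  = ⊥-elim (none (e , label≡i , Fe≢𝟘))

    𝟙-isNZFlow : 𝟙 (isNZFlow? G FG hs f) ≡ 𝟙 (isNZFlowᴮᴳ? r)
    𝟙-isNZFlow = 𝟙-cong (λ (flow , nz) → let (in≡𝟘 , out≡𝟘) = isFlow⇒ flow in in≡𝟘 , out≡𝟘 , nowhereZero⇒ nz)
                        (λ (in≡𝟘 , out≡𝟘 , nz) → isFlow⇐ (in≡𝟘 , out≡𝟘) , nowhereZero⇐ nz) _ _

  #NZFlows : ∀ {n m} (hs : Hyp n m) (ch : Choice hs) →
             numNZFlows G FG hs ≡ ∑ˡ (sgEdges hs ch) (𝟙 ∘ Transfer.isNZFlowˢᴳ? finGroup hs ch)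
  #NZFlows hs ch = begin
    numNZFlows G FG hs                                                   ≡⟨ count-allVecs (NB G FG hs) _ ⟩
    ∑ᵛ (NB G FG hs) (λ F → 𝟙 (isNZFlow? G FG hs (enum ∘ Vec.lookup F)))  ≡⟨ ∑ᵛ-cong (NB G FG hs) (𝟙-isNZFlow hs ch) ⟩
    ∑ᵛ (NB G FG hs) (λ F → 𝟙 (isNZFlowᴮᴳ? (zipLabels (bgEdges hs) F)))   ≡⟨ ∑ᵛ-zipLabels (bgEdges hs) (𝟙 ∘ isNZFlowᴮᴳ?) ⟩
    ∑ˡ (bgEdges hs) (𝟙 ∘ isNZFlowᴮᴳ?)                                    ≡⟨ transfer ⟩
    ∑ˡ (sgEdges hs ch) (𝟙 ∘ isNZFlowˢᴳ?)                                 ∎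
    where
    open ≡-Reasoning
    open Transfer finGroup hs ch

theorem8p4 : ∀ {c ℓ} (G : AbelianGroup c ℓ) (FG : FiniteEnum G)
             {n m : ℕ} (hs : Hyp n m) (ch : Choice hs)
             (r : Subset m → ℕ) → IsRankPH hs ch r →
             + numNZFlows G FG hs ≡ charPoly (dualRank r (aVec hs)) (FiniteEnum.size FG)
theorem8p4 G FG hs ch r isRank = trans (cong +_ (#NZFlows hs ch)) (#NZFlowsˢᴳ finGroup hs ch r isRank)
  where open OnFin G FG
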